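{- Let $K$ be an imaginary quadratic number field. Every element of $\mathbb{P}^1(K)$ has infinitely many $K$-Farey neighbours.
   Context: $\mathcal{O}_K$ is the ring of integers of $K$. Elements of $\mathbb{P}^1(K)=K\cup\{\infty\}$ are written $\frac ab$ with $a,b\in\mathcal{O}_K$ not both zero, with $\frac a0=\infty$. Two distinct elements $x,y\in\mathbb{P}^1(K)$ are $K$-Farey neighbours if for any $a,b,c,d\in\mathcal{O}_K$ such that $x=\frac ab$ and $y=\frac cd$, the ideals satisfy $(a\mathcal{O}_K+b\mathcal{O}_K)(c\mathcal{O}_K+d\mathcal{O}_K)=(ad-bc)\mathcal{O}_K$ (this does not depend on the choice of $a,b,c,d$). -}

module Defs where

open import Data.Nat as ℕ using (ℕ; _≡ᵇ_)
open import Data.Nat.Divisibility as ℕD using ()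
open import Data.Integer as ℤ using (ℤ; +_)
open import Data.Bool using (if_then_else_)
open import Data.Product using (Σ; ∃; ∃-syntax; _×_; _,_)
open import Data.List using (List; []; _∷_; foldr; map)
open import Data.List.Relation.Unary.All using (All)
open import Relation.Binary.PropositionalEquality using (_≡_)
open import Relation.Nullary using (¬_)

SquareFree : ℕ → Set
SquareFree D = ∀ (p : ℕ) → (p ℕ.* p) ℕD.∣ D → p ≡ 1

-- Every imaginary quadratic field is K = ℚ(√-D) for a unique squarefree D ≥ 1.
-- Its ring of integers is ℤ[ω] with
--   ω = (1 + √-D)/2   if D ≡ 3 (mod 4)  (i.e. -D ≡ 1 mod 4),  ω² = ω - (D+1)/4,
--   ω = √-D           otherwise,                               ω² = -D.
-- In both cases ω² = t·ω - n with (t , n) as below.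
module QuadInt (D : ℕ) where

  t : ℤ
  t = if (D ℕ.% 4) ≡ᵇ 3 then + 1 else + 0

  n : ℤ
  n = if (D ℕ.% 4) ≡ᵇ 3 then + ((D ℕ.+ 1) ℕ./ 4) else + D

  record 𝒪 : Set where
    constructor _+_ω
    field
      re : ℤ
      im : ℤ
  open 𝒪 public

  infixl 6 _+ₒ_ _-ₒ_
  infixl 7 _*ₒ_

  0ₒ : 𝒪
  0ₒ = (+ 0) + (+ 0) ω

  _+ₒ_ : 𝒪 → 𝒪 → 𝒪
  (a + b ω) +ₒ (c + d ω) = (a ℤ.+ c) + (b ℤ.+ d) ω

  -ₒ_ : 𝒪 → 𝒪
  -ₒ (a + b ω) = (ℤ.- a) + (ℤ.- b) ω

  _-ₒ_ : 𝒪 → 𝒪 → 𝒪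
  x -ₒ y = x +ₒ (-ₒ y)

  _*ₒ_ : 𝒪 → 𝒪 → 𝒪
  (a + b ω) *ₒ (c + d ω) =
    (a ℤ.* c ℤ.- n ℤ.* (b ℤ.* d)) + (a ℤ.* d ℤ.+ b ℤ.* c ℤ.+ t ℤ.* (b ℤ.* d)) ω

  sumₒ : List 𝒪 → 𝒪
  sumₒ = foldr _+ₒ_ 0ₒ

  Ideal : Set₁
  Ideal = 𝒪 → Set

  ⟦_∣_⟧ : 𝒪 → 𝒪 → Ideal
  ⟦ a ∣ b ⟧ z = ∃[ r ] ∃[ s ] (z ≡ r *ₒ a +ₒ s *ₒ b)

  ⟨_⟩ : 𝒪 → Ideal
  ⟨ g ⟩ z = ∃[ r ] (z ≡ r *ₒ g)

  _·_ : Ideal → Ideal → Ideal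
  (I · J) z = ∃[ l ] (All (λ p → I (Data.Product.proj₁ p) × J (Data.Product.proj₂ p)) l
                     × z ≡ sumₒ (map (λ p → Data.Product.proj₁ p *ₒ Data.Product.proj₂ p) l))

  _≐_ : Ideal → Ideal → Set
  I ≐ J = ∀ z → (I z → J z) × (J z → I z)

  record Rep : Set where
    constructor _/_∶_
    field
      num : 𝒪
      den : 𝒪
      nonzero : ¬ (num ≡ 0ₒ × den ≡ 0ₒ)
  open Rep public

  _~_ : Rep → Rep → Set
  x ~ y = num x *ₒ den y ≡ den x *ₒ num y

  FareyNeighbours : Rep → Rep → Set
  FareyNeighbours x y =
    ¬ (x ~ y) ×
    (∀ (x' y' : Rep) → x' ~ x → y' ~ y →
       (⟦ num x' ∣ den x' ⟧ · ⟦ num y' ∣ den y' ⟧)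
         ≐ ⟨ num x' *ₒ den y' -ₒ den x' *ₒ num y' ⟩)

  InfiniteP1 : (Rep → Set) → Set
  InfiniteP1 P = ∀ (L : List Rep) → ∃[ y ] (P y × All (λ z → ¬ (y ~ z)) L)

-- Write x = a/b. If δ = ad − bc is nonzero and divides ac, ad, bc and bd, then
-- (a, b)(c, d) = (δ), and this persists when (a, b) or (c, d) is replaced by a proportional
-- pair, so c/d is a Farey neighbour of x; so is (c + kδa)/(d + kδb) for every k ∈ ℕ, and
-- these points are pairwise distinct. Such c and d exist because (a, b) is invertible: after
-- multiplying by the conjugate of a and dividing by the content we may assume a = A ∈ ℤ and
-- gcd(A, p, q) = 1 for b = p + qω. Then some β = f + ω lies in (A, b), and (A, b) = (e, β)
-- with e = gcd(A, p − qf, N β). As D is squarefree, e, Tr β and N β / e are coprime, whence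
-- (e, β)(e, β̄) = (e), and c, d can be read off from e ∈ (a, b)(e, β̄).
module Submission where

open import Defs
open import Data.Nat as ℕ using (ℕ; zero; suc; _≤_; _≡ᵇ_; _%_; _/_)
import Data.Nat.Properties as ℕ
import Data.Nat.Divisibility as ℕ
import Data.Nat.GCD as ℕ
open import Data.Nat.DivMod using (m≡m%n+[m/n]*n; m*n/n≡m; %-pred-≡0)
import Data.Nat.Tactic.RingSolver as ℕ-Solver
open import Data.Integer as ℤ using (ℤ; +_; -[1+_]; ∣_∣)
import Data.Integer.Properties as ℤ
open import Data.Integer.Divisibility.Signed as ℤ∣ using (divides; ∣ᵤ⇒∣; ∣⇒∣ᵤ)
open import Data.Integer.Tactic.RingSolver using (solve-∀)
open import Data.Bool using (Bool; true; false; T; if_then_else_)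
open import Data.List using (List; []; _∷_; map)
open import Data.List.Relation.Unary.All as All using (All)
open import Data.Product using (_×_; _,_; ∃₂; ∃-syntax; proj₁; proj₂)
open import Data.Sum using (_⊎_; inj₁; inj₂; [_,_]′)
open import Data.Empty using (⊥; ⊥-elim)
open import Relation.Binary.PropositionalEquality
open import Relation.Nullary using (¬_; Dec; yes; no)
open import Relation.Nullary.Decidable using (dec⇒maybe)
open import Algebra.Bundles using (CommutativeRing)
open import Algebra.Structures using (IsCommutativeRing)
import Tactic.RingSolver.Core.AlmostCommutativeRing as ACR
import Tactic.RingSolver as 𝒪

record Bézout (i j : ℤ) : Set where
  constructor bézout
  field
    gcd      : ℕ
    x y      : ℤ
    identity : x ℤ.* i ℤ.+ y ℤ.* j ≡ + gcd
    gcd∣i    : + gcd ℤ∣.∣ i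
    gcd∣j    : + gcd ℤ∣.∣ j

record Bézout₃ (i j k : ℤ) : Set where
  constructor bézout₃
  field
    gcd      : ℕ
    x y z    : ℤ
    identity : x ℤ.* i ℤ.+ y ℤ.* j ℤ.+ z ℤ.* k ≡ + gcd
    gcd∣i    : + gcd ℤ∣.∣ i
    gcd∣j    : + gcd ℤ∣.∣ j
    gcd∣k    : + gcd ℤ∣.∣ k

abs-unit-multiple : ∀ i → ∃[ s ] (s ℤ.* i ≡ + ∣ i ∣)
abs-unit-multiple (+ m)    = + 1 , ℤ.*-identityˡ (+ m)
abs-unit-multiple -[1+ m ] = ℤ.- + 1 , ℤ.-1*i≡-i -[1+ m ]

ℕ-identity⇒ℤ : ∀ i j d x y → d ℕ.+ y ℕ.* ∣ j ∣ ≡ x ℕ.* ∣ i ∣ → ∃₂ λ u v → u ℤ.* i ℤ.+ v ℤ.* j ≡ + d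
ℕ-identity⇒ℤ i j d x y d+y∣j∣≡x∣i∣ with abs-unit-multiple i | abs-unit-multiple j
... | s , si≡∣i∣ | r , rj≡∣j∣ = + x ℤ.* s , ℤ.- + y ℤ.* r , (begin
  + x ℤ.* s ℤ.* i ℤ.+ ℤ.- + y ℤ.* r ℤ.* j     ≡⟨ regroup (+ x) (+ y) s r i j ⟩
  + x ℤ.* (s ℤ.* i) ℤ.- + y ℤ.* (r ℤ.* j)     ≡⟨ cong₂ (λ u v → + x ℤ.* u ℤ.- + y ℤ.* v) si≡∣i∣ rj≡∣j∣ ⟩
  + x ℤ.* + ∣ i ∣ ℤ.- + y ℤ.* + ∣ j ∣         ≡⟨ cong₂ ℤ._-_ (ℤ.pos-* x ∣ i ∣) (ℤ.pos-* y ∣ j ∣) ⟨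
  + (x ℕ.* ∣ i ∣) ℤ.- + (y ℕ.* ∣ j ∣)         ≡⟨ cong (λ u → + u ℤ.- + (y ℕ.* ∣ j ∣)) d+y∣j∣≡x∣i∣ ⟨
  + (d ℕ.+ y ℕ.* ∣ j ∣) ℤ.- + (y ℕ.* ∣ j ∣)   ≡⟨ cong (ℤ._- + (y ℕ.* ∣ j ∣)) (ℤ.pos-+ d (y ℕ.* ∣ j ∣)) ⟩
  + d ℤ.+ + (y ℕ.* ∣ j ∣) ℤ.- + (y ℕ.* ∣ j ∣) ≡⟨ cancel (+ d) (+ (y ℕ.* ∣ j ∣)) ⟩
  + d                                        ∎)
  where
  open ≡-Reasoning
  regroup : ∀ x y s r i j → x ℤ.* s ℤ.* i ℤ.+ ℤ.- y ℤ.* r ℤ.* j ≡ x ℤ.* (s ℤ.* i) ℤ.- y ℤ.* (r ℤ.* j)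
  regroup = solve-∀
  cancel : ∀ a b → a ℤ.+ b ℤ.- b ≡ a
  cancel = solve-∀

bézout-ℤ : ∀ i j → Bézout i j
bézout-ℤ i j with ℕ.Bézout.lemma ∣ i ∣ ∣ j ∣
... | ℕ.Bézout.result d g (ℕ.Bézout.+- x y d+y∣j∣≡x∣i∣) =
  let u , v , ui+vj≡d = ℕ-identity⇒ℤ i j d x y d+y∣j∣≡x∣i∣
  in bézout d u v ui+vj≡d (∣ᵤ⇒∣ (ℕ.GCD.gcd∣m g)) (∣ᵤ⇒∣ (ℕ.GCD.gcd∣n g))
... | ℕ.Bézout.result d g (ℕ.Bézout.-+ x y d+x∣i∣≡y∣j∣) =
  let v , u , vj+ui≡d = ℕ-identity⇒ℤ j i d y x d+x∣i∣≡y∣j∣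
  in bézout d u v (trans (ℤ.+-comm (u ℤ.* i) (v ℤ.* j)) vj+ui≡d) (∣ᵤ⇒∣ (ℕ.GCD.gcd∣m g)) (∣ᵤ⇒∣ (ℕ.GCD.gcd∣n g))

bézout₃-ℤ : ∀ i j k → Bézout₃ i j k
bézout₃-ℤ i j k with bézout-ℤ i j
... | bézout g₁ x₁ y₁ id₁ g₁∣i g₁∣j with bézout-ℤ (+ g₁) k
...   | bézout g x₂ z id₂ g∣g₁ g∣k =
  bézout₃ g (x₂ ℤ.* x₁) (x₂ ℤ.* y₁) z
    (trans (regroup x₁ y₁ x₂ z i j k) (trans (cong (λ u → x₂ ℤ.* u ℤ.+ z ℤ.* k) id₁) id₂))
    (ℤ∣.∣-trans g∣g₁ g₁∣i) (ℤ∣.∣-trans g∣g₁ g₁∣j) g∣k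
  where
  regroup : ∀ x₁ y₁ x₂ z i j k →
    x₂ ℤ.* x₁ ℤ.* i ℤ.+ x₂ ℤ.* y₁ ℤ.* j ℤ.+ z ℤ.* k ≡ x₂ ℤ.* (x₁ ℤ.* i ℤ.+ y₁ ℤ.* j) ℤ.+ z ℤ.* k
  regroup = solve-∀

module _ {A : Set} {_≈_ : A → A → Set} (≈-dec : ∀ u v → Dec (u ≈ v))
         (≈-euclidean : ∀ u v w → u ≈ w → v ≈ w → u ≈ v) where

  injective-family-escapes : (f : ℕ → A) → (∀ k j → f k ≈ f j → k ≡ j) →
                             ∀ L → ∃[ k ] All (λ z → ¬ f k ≈ z) L
  injective-family-escapes f f-injective L = let k , _ , escapes = beyond L 0 in k , escapes
    where
    Escapes-beyond : List A → ℕ → Set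
    Escapes-beyond L m = ∃[ k ] (m ≤ k × All (λ z → ¬ f k ≈ z) L)
    -- Once f k ≈ z, no f k′ with k′ ≠ k is ≈ z, so it suffices to look beyond k.
    extend : ∀ z {L} m → (∀ m′ → Escapes-beyond L m′) → Escapes-beyond L m → Escapes-beyond (z ∷ L) m
    extend z m beyond-L (k , m≤k , escapes) with ≈-dec (f k) z
    ... | no fk≉z = k , m≤k , fk≉z All.∷ escapes
    ... | yes fk≈z = let k′ , k<k′ , escapes′ = beyond-L (suc k) in
      k′ , ℕ.≤-trans m≤k (ℕ.<⇒≤ k<k′) ,
      (λ fk′≈z → ℕ.<⇒≢ k<k′ (f-injective k k′ (≈-euclidean (f k) (f k′) z fk≈z fk′≈z))) All.∷ escapes′
    beyond : ∀ L m → Escapes-beyond L m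
    beyond [] m = m , ℕ.≤-refl , All.[]
    beyond (z ∷ L) m = extend z m (beyond L) (beyond L m)

-- The ring 𝒪 = ℤ[ω]

module QuadraticRing (D : ℕ) where
  open QuadInt D

  1ₒ : 𝒪
  1ₒ = (+ 1) + (+ 0) ω

  ι : ℤ → 𝒪
  ι i = i + (+ 0) ω

  _≟ₒ_ : (x y : 𝒪) → Dec (x ≡ y)
  (a + b ω) ≟ₒ (c + d ω) with a ℤ.≟ c | b ℤ.≟ d
  ... | yes refl | yes refl = yes refl
  ... | no a≢c   | _        = no λ eq → a≢c (cong re eq)
  ... | yes _    | no b≢d   = no λ eq → b≢d (cong im eq)

  -- _*ₒ_ multiplies by n on the left, and n ℤ.* + 0 does not reduce while n is stuck on D;
  -- the ring solver computes with closed coefficients, so the ring structure uses this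
  -- reordered product (equal to _*ₒ_ by ⊗≡*ₒ) and ring identities are stated with ⊕ ⊗ ⊝ ⊖.
  infixl 7 _⊛_
  private
    _⊛_ : 𝒪 → 𝒪 → 𝒪
    (a + b ω) ⊛ (c + d ω) = (a ℤ.* c ℤ.- b ℤ.* d ℤ.* n) + (a ℤ.* d ℤ.+ b ℤ.* c ℤ.+ b ℤ.* d ℤ.* t) ω

    +-assoc : ∀ x y z → (x +ₒ y) +ₒ z ≡ x +ₒ (y +ₒ z)
    +-assoc (a + b ω) (c + d ω) (e + f ω) = cong₂ _+_ω (ℤ.+-assoc a c e) (ℤ.+-assoc b d f)

    +-comm : ∀ x y → x +ₒ y ≡ y +ₒ x
    +-comm (a + b ω) (c + d ω) = cong₂ _+_ω (ℤ.+-comm a c) (ℤ.+-comm b d)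

    +-identityˡ : ∀ x → 0ₒ +ₒ x ≡ x
    +-identityˡ (a + b ω) = cong₂ _+_ω (ℤ.+-identityˡ a) (ℤ.+-identityˡ b)

    +-identityʳ : ∀ x → x +ₒ 0ₒ ≡ x
    +-identityʳ x = trans (+-comm x 0ₒ) (+-identityˡ x)

    -‿inverseˡ : ∀ x → (-ₒ x) +ₒ x ≡ 0ₒ
    -‿inverseˡ (a + b ω) = cong₂ _+_ω (ℤ.+-inverseˡ a) (ℤ.+-inverseˡ b)

    -‿inverseʳ : ∀ x → x +ₒ (-ₒ x) ≡ 0ₒ
    -‿inverseʳ x = trans (+-comm x (-ₒ x)) (-‿inverseˡ x)

    *-comm : ∀ x y → x ⊛ y ≡ y ⊛ x
    *-comm (a + b ω) (c + d ω) = cong₂ _+_ω (re-comm t n a b c d) (im-comm t n a b c d)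
      where
      re-comm : ∀ t n a b c d → a ℤ.* c ℤ.- b ℤ.* d ℤ.* n ≡ c ℤ.* a ℤ.- d ℤ.* b ℤ.* n
      re-comm = solve-∀
      im-comm : ∀ t n a b c d →
        a ℤ.* d ℤ.+ b ℤ.* c ℤ.+ b ℤ.* d ℤ.* t ≡ c ℤ.* b ℤ.+ d ℤ.* a ℤ.+ d ℤ.* b ℤ.* t
      im-comm = solve-∀

    *-assoc : ∀ x y z → (x ⊛ y) ⊛ z ≡ x ⊛ (y ⊛ z)
    *-assoc (a + b ω) (c + d ω) (e + f ω) =
      cong₂ _+_ω (re-assoc t n a b c d e f) (im-assoc t n a b c d e f)
      where
      re-assoc : ∀ t n a b c d e f →
        (a ℤ.* c ℤ.- b ℤ.* d ℤ.* n) ℤ.* e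
          ℤ.- (a ℤ.* d ℤ.+ b ℤ.* c ℤ.+ b ℤ.* d ℤ.* t) ℤ.* f ℤ.* n
        ≡ a ℤ.* (c ℤ.* e ℤ.- d ℤ.* f ℤ.* n)
          ℤ.- b ℤ.* (c ℤ.* f ℤ.+ d ℤ.* e ℤ.+ d ℤ.* f ℤ.* t) ℤ.* n
      re-assoc = solve-∀
      im-assoc : ∀ t n a b c d e f →
        (a ℤ.* c ℤ.- b ℤ.* d ℤ.* n) ℤ.* f ℤ.+ (a ℤ.* d ℤ.+ b ℤ.* c ℤ.+ b ℤ.* d ℤ.* t) ℤ.* e
          ℤ.+ (a ℤ.* d ℤ.+ b ℤ.* c ℤ.+ b ℤ.* d ℤ.* t) ℤ.* f ℤ.* t
        ≡ a ℤ.* (c ℤ.* f ℤ.+ d ℤ.* e ℤ.+ d ℤ.* f ℤ.* t) ℤ.+ b ℤ.* (c ℤ.* e ℤ.- d ℤ.* f ℤ.* n)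
          ℤ.+ b ℤ.* (c ℤ.* f ℤ.+ d ℤ.* e ℤ.+ d ℤ.* f ℤ.* t) ℤ.* t
      im-assoc = solve-∀

    *-identityˡ : ∀ x → 1ₒ ⊛ x ≡ x
    *-identityˡ (a + b ω) = cong₂ _+_ω (re-id n a b) (im-id t a b)
      where
      re-id : ∀ n a b → + 1 ℤ.* a ℤ.- + 0 ℤ.* b ℤ.* n ≡ a
      re-id = solve-∀
      im-id : ∀ t a b → + 1 ℤ.* b ℤ.+ + 0 ℤ.* a ℤ.+ + 0 ℤ.* b ℤ.* t ≡ b
      im-id = solve-∀

    *-identityʳ : ∀ x → x ⊛ 1ₒ ≡ x
    *-identityʳ x = trans (*-comm x 1ₒ) (*-identityˡ x)

    *-distribˡ-+ : ∀ x y z → x ⊛ (y +ₒ z) ≡ x ⊛ y +ₒ x ⊛ z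
    *-distribˡ-+ (a + b ω) (c + d ω) (e + f ω) =
      cong₂ _+_ω (re-distrib t n a b c d e f) (im-distrib t n a b c d e f)
      where
      re-distrib : ∀ t n a b c d e f →
        a ℤ.* (c ℤ.+ e) ℤ.- b ℤ.* (d ℤ.+ f) ℤ.* n
        ≡ (a ℤ.* c ℤ.- b ℤ.* d ℤ.* n) ℤ.+ (a ℤ.* e ℤ.- b ℤ.* f ℤ.* n)
      re-distrib = solve-∀
      im-distrib : ∀ t n a b c d e f →
        a ℤ.* (d ℤ.+ f) ℤ.+ b ℤ.* (c ℤ.+ e) ℤ.+ b ℤ.* (d ℤ.+ f) ℤ.* t
        ≡ (a ℤ.* d ℤ.+ b ℤ.* c ℤ.+ b ℤ.* d ℤ.* t) ℤ.+ (a ℤ.* f ℤ.+ b ℤ.* e ℤ.+ b ℤ.* f ℤ.* t)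
      im-distrib = solve-∀

    *-distribʳ-+ : ∀ x y z → (y +ₒ z) ⊛ x ≡ y ⊛ x +ₒ z ⊛ x
    *-distribʳ-+ x y z = begin
      (y +ₒ z) ⊛ x         ≡⟨ *-comm (y +ₒ z) x ⟩
      x ⊛ (y +ₒ z)         ≡⟨ *-distribˡ-+ x y z ⟩
      x ⊛ y +ₒ x ⊛ z      ≡⟨ cong₂ _+ₒ_ (*-comm x y) (*-comm x z) ⟩
      y ⊛ x +ₒ z ⊛ x      ∎
      where open ≡-Reasoning

  isCommutativeRing : IsCommutativeRing _≡_ _+ₒ_ _⊛_ (-ₒ_) 0ₒ 1ₒ
  isCommutativeRing = record
    { isRing = record
      { +-isAbelianGroup = record
        { isGroup = record
          { isMonoid = record
            { isSemigroup = record
              { isMagma = record { isEquivalence = isEquivalence ; ∙-cong = cong₂ _+ₒ_ }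
              ; assoc = +-assoc }
            ; identity = +-identityˡ , +-identityʳ }
          ; inverse = -‿inverseˡ , -‿inverseʳ
          ; ⁻¹-cong = cong (-ₒ_) }
        ; comm = +-comm }
      ; *-cong = cong₂ _⊛_
      ; *-assoc = *-assoc
      ; *-identity = *-identityˡ , *-identityʳ
      ; distrib = *-distribˡ-+ , *-distribʳ-+ }
    ; *-comm = *-comm }

  commutativeRing : CommutativeRing _ _
  commutativeRing = record { isCommutativeRing = isCommutativeRing }

  ring : ACR.AlmostCommutativeRing _ _
  ring = ACR.fromCommutativeRing commutativeRing (λ x → dec⇒maybe (0ₒ ≟ₒ x))

  open ACR.AlmostCommutativeRing ring public using ()
    renaming (_+_ to infixl 6 _⊕_; _*_ to infixl 7 _⊗_; -_ to infix 8 ⊝_; _-_ to infixl 6 _⊖_)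
  open CommutativeRing commutativeRing public using () renaming (*-comm to ⊗-comm)

  ⊗≡*ₒ : ∀ x y → x ⊗ y ≡ x *ₒ y
  ⊗≡*ₒ (a + b ω) (c + d ω) = cong₂ _+_ω (cong (λ m → a ℤ.* c ℤ.- m) (ℤ.*-comm (b ℤ.* d) n))
                                          (cong (λ m → a ℤ.* d ℤ.+ b ℤ.* c ℤ.+ m) (ℤ.*-comm (b ℤ.* d) t))

  conj : 𝒪 → 𝒪
  conj (a + b ω) = (a ℤ.+ t ℤ.* b) + (ℤ.- b) ω

  N : 𝒪 → ℤ
  N (a + b ω) = a ℤ.* a ℤ.+ t ℤ.* (a ℤ.* b) ℤ.+ n ℤ.* (b ℤ.* b)

  conj-⊗ : ∀ x → conj x ⊗ x ≡ ι (N x)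
  conj-⊗ (a + b ω) = cong₂ _+_ω (re-norm t n a b) (im-norm t n a b)
    where
    re-norm : ∀ t n a b →
      (a ℤ.+ t ℤ.* b) ℤ.* a ℤ.- ℤ.- b ℤ.* b ℤ.* n ≡ a ℤ.* a ℤ.+ t ℤ.* (a ℤ.* b) ℤ.+ n ℤ.* (b ℤ.* b)
    re-norm = solve-∀
    im-norm : ∀ t n a b → (a ℤ.+ t ℤ.* b) ℤ.* b ℤ.+ ℤ.- b ℤ.* a ℤ.+ ℤ.- b ℤ.* b ℤ.* t ≡ + 0
    im-norm = solve-∀

  N-⊗ : ∀ x y → N (x ⊗ y) ≡ N x ℤ.* N y
  N-⊗ (a + b ω) (c + d ω) = norm-mult t n a b c d
    where
    norm-mult : ∀ t n a b c d →
      let r = a ℤ.* c ℤ.- b ℤ.* d ℤ.* n ; s = a ℤ.* d ℤ.+ b ℤ.* c ℤ.+ b ℤ.* d ℤ.* t in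
      r ℤ.* r ℤ.+ t ℤ.* (r ℤ.* s) ℤ.+ n ℤ.* (s ℤ.* s)
      ≡ (a ℤ.* a ℤ.+ t ℤ.* (a ℤ.* b) ℤ.+ n ℤ.* (b ℤ.* b)) ℤ.* (c ℤ.* c ℤ.+ t ℤ.* (c ℤ.* d) ℤ.+ n ℤ.* (d ℤ.* d))
    norm-mult = solve-∀

  ι-⊗ : ∀ i j → ι (i ℤ.* j) ≡ ι i ⊗ ι j
  ι-⊗ i j = cong₂ _+_ω (re-ι t n i j) (im-ι t n i j)
    where
    re-ι : ∀ t n i j → i ℤ.* j ≡ i ℤ.* j ℤ.- + 0 ℤ.* + 0 ℤ.* n
    re-ι = solve-∀
    im-ι : ∀ t n i j → + 0 ≡ i ℤ.* + 0 ℤ.+ + 0 ℤ.* j ℤ.+ + 0 ℤ.* + 0 ℤ.* t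
    im-ι = solve-∀

  ι-scale : ∀ g p q → ι g ⊗ (p + q ω) ≡ (g ℤ.* p) + (g ℤ.* q) ω
  ι-scale g p q = cong₂ _+_ω (re-scale t n g p q) (im-scale t n g p q)
    where
    re-scale : ∀ t n g p q → g ℤ.* p ℤ.- + 0 ℤ.* q ℤ.* n ≡ g ℤ.* p
    re-scale = solve-∀
    im-scale : ∀ t n g p q → g ℤ.* q ℤ.+ + 0 ℤ.* p ℤ.+ + 0 ℤ.* q ℤ.* t ≡ g ℤ.* q
    im-scale = solve-∀

  N-0ₒ : N 0ₒ ≡ + 0
  N-0ₒ = norm-zero t n
    where
    norm-zero : ∀ t n → + 0 ℤ.* + 0 ℤ.+ t ℤ.* (+ 0 ℤ.* + 0) ℤ.+ n ℤ.* (+ 0 ℤ.* + 0) ≡ + 0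
    norm-zero = solve-∀

  ⊖≡0⇒≡ : ∀ x y → x ⊖ y ≡ 0ₒ → x ≡ y
  ⊖≡0⇒≡ x y x-y≡0 = begin
    x            ≡⟨ 𝒪.solve (x ∷ y ∷ []) ring ⟩
    (x ⊖ y) ⊕ y  ≡⟨ cong (_⊕ y) x-y≡0 ⟩
    0ₒ ⊕ y       ≡⟨ 𝒪.solve (y ∷ []) ring ⟩
    y            ∎
    where open ≡-Reasoning

  ≡⇒⊖≡0 : ∀ x y → x ≡ y → x ⊖ y ≡ 0ₒ
  ≡⇒⊖≡0 x .x refl = 𝒪.solve (x ∷ []) ring

-- Farey quadruples

module FareyQuadruples (D : ℕ) (N≡0⇒≡0 : ∀ x → QuadraticRing.N D x ≡ + 0 → x ≡ QuadInt.0ₒ D) where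
  open QuadInt D
  open QuadraticRing D
  open import Algebra.Properties.CommutativeSemigroup.Divisibility
    (CommutativeRing.*-commutativeSemigroup commutativeRing) public using (_∣_; _,_)

  ⊗-zero-divisor : ∀ x y → x ⊗ y ≡ 0ₒ → x ≡ 0ₒ ⊎ y ≡ 0ₒ
  ⊗-zero-divisor x y xy≡0 =
    [ (λ Nx≡0 → inj₁ (N≡0⇒≡0 x Nx≡0)) , (λ Ny≡0 → inj₂ (N≡0⇒≡0 y Ny≡0)) ]′
      (ℤ.i*j≡0⇒i≡0∨j≡0 (N x) {N y} (trans (sym (N-⊗ x y)) (trans (cong N xy≡0) N-0ₒ)))

  ⊗-cancelʳ : ∀ {z} → ¬ z ≡ 0ₒ → ∀ x y → x ⊗ z ≡ y ⊗ z → x ≡ y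
  ⊗-cancelʳ {z} z≢0 x y xz≡yz =
    [ ⊖≡0⇒≡ x y , (λ z≡0 → ⊥-elim (z≢0 z≡0)) ]′ (⊗-zero-divisor (x ⊖ y) z [x-y]z≡0)
    where
    [x-y]z≡0 : (x ⊖ y) ⊗ z ≡ 0ₒ
    [x-y]z≡0 = begin
      (x ⊖ y) ⊗ z    ≡⟨ 𝒪.solve (x ∷ y ∷ z ∷ []) ring ⟩
      x ⊗ z ⊖ y ⊗ z  ≡⟨ ≡⇒⊖≡0 (x ⊗ z) (y ⊗ z) xz≡yz ⟩
      0ₒ             ∎
      where open ≡-Reasoning

  ⊗≡0⇒≡0 : ∀ {z} → ¬ z ≡ 0ₒ → ∀ x → x ⊗ z ≡ 0ₒ → x ≡ 0ₒ
  ⊗≡0⇒≡0 z≢0 x xz≡0 = [ (λ x≡0 → x≡0) , (λ z≡0 → ⊥-elim (z≢0 z≡0)) ]′ (⊗-zero-divisor x _ xz≡0)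

  ∣-⊕ : ∀ {d x y} → d ∣ x → d ∣ y → d ∣ x ⊕ y
  ∣-⊕ {d} (p , refl) (q , refl) = p ⊕ q , distrib
    where
    distrib : (p ⊕ q) ⊗ d ≡ p ⊗ d ⊕ q ⊗ d
    distrib = 𝒪.solve (p ∷ q ∷ d ∷ []) ring

  ∣-⊗ʳ : ∀ {d x} y → d ∣ x → d ∣ x ⊗ y
  ∣-⊗ʳ {d} y (p , refl) = p ⊗ y , reorder
    where
    reorder : p ⊗ y ⊗ d ≡ p ⊗ d ⊗ y
    reorder = 𝒪.solve (p ∷ y ∷ d ∷ []) ring

  ⊝-∣ : ∀ {d x} → d ∣ x → ⊝ d ∣ x
  ⊝-∣ {d} (p , refl) = ⊝ p , neg-neg
    where
    neg-neg : ⊝ p ⊗ ⊝ d ≡ p ⊗ d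
    neg-neg = 𝒪.solve (p ∷ d ∷ []) ring

  det : 𝒪 → 𝒪 → 𝒪 → 𝒪 → 𝒪
  det a b c d = a ⊗ d ⊖ b ⊗ c

  record IsFareyQuadruple (a b c d : 𝒪) : Set where
    field
      det≢0  : ¬ det a b c d ≡ 0ₒ
      det∣ac : det a b c d ∣ a ⊗ c
      det∣ad : det a b c d ∣ a ⊗ d
      det∣bc : det a b c d ∣ b ⊗ c
      det∣bd : det a b c d ∣ b ⊗ d

  FareyPartner : 𝒪 → 𝒪 → Set
  FareyPartner a b = ∃₂ λ c d → IsFareyQuadruple a b c d

  ∣-transport : ∀ {δ δ′} u u′ → ¬ δ ≡ 0ₒ → u′ ⊗ δ ≡ u ⊗ δ′ → ∀ s → δ ∣ u ⊗ s → δ′ ∣ u′ ⊗ s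
  ∣-transport {δ} {δ′} u u′ δ≢0 u′δ≡uδ′ s (r , rδ≡us) = r , ⊗-cancelʳ δ≢0 _ _ (begin
    r ⊗ δ′ ⊗ δ    ≡⟨ 𝒪.solve (r ∷ δ ∷ δ′ ∷ []) ring ⟩
    r ⊗ δ ⊗ δ′    ≡⟨ cong (_⊗ δ′) rδ≡us ⟩
    u ⊗ s ⊗ δ′    ≡⟨ 𝒪.solve (u ∷ s ∷ δ′ ∷ []) ring ⟩
    s ⊗ (u ⊗ δ′)  ≡⟨ cong (s ⊗_) u′δ≡uδ′ ⟨
    s ⊗ (u′ ⊗ δ)  ≡⟨ 𝒪.solve (s ∷ u′ ∷ δ ∷ []) ring ⟩
    u′ ⊗ s ⊗ δ    ∎)
    where open ≡-Reasoning

  IsFareyQuadruple-respˡ : ∀ {a b c d} a′ b′ → IsFareyQuadruple a b c d →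
                           a′ ⊗ b ≡ b′ ⊗ a → ¬ (a′ ≡ 0ₒ × b′ ≡ 0ₒ) → IsFareyQuadruple a′ b′ c d
  IsFareyQuadruple-respˡ {a} {b} {c} {d} a′ b′ q a′b≡b′a nonzero = record
    { det≢0  = δ′≢0
    ; det∣ac = ∣-transport a a′ det≢0 a′δ≡aδ′ c det∣ac
    ; det∣ad = ∣-transport a a′ det≢0 a′δ≡aδ′ d det∣ad
    ; det∣bc = ∣-transport b b′ det≢0 b′δ≡bδ′ c det∣bc
    ; det∣bd = ∣-transport b b′ det≢0 b′δ≡bδ′ d det∣bd
    }
    where
    open IsFareyQuadruple q
    open ≡-Reasoning
    a′δ≡aδ′ : a′ ⊗ det a b c d ≡ a ⊗ det a′ b′ c d
    a′δ≡aδ′ = begin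
      a′ ⊗ (a ⊗ d ⊖ b ⊗ c)       ≡⟨ 𝒪.solve (a ∷ b ∷ c ∷ d ∷ a′ ∷ []) ring ⟩
      a ⊗ (a′ ⊗ d) ⊖ a′ ⊗ b ⊗ c  ≡⟨ cong (λ m → a ⊗ (a′ ⊗ d) ⊖ m ⊗ c) a′b≡b′a ⟩
      a ⊗ (a′ ⊗ d) ⊖ b′ ⊗ a ⊗ c  ≡⟨ 𝒪.solve (a ∷ c ∷ d ∷ a′ ∷ b′ ∷ []) ring ⟩
      a ⊗ (a′ ⊗ d ⊖ b′ ⊗ c)      ∎
    b′δ≡bδ′ : b′ ⊗ det a b c d ≡ b ⊗ det a′ b′ c d
    b′δ≡bδ′ = begin
      b′ ⊗ (a ⊗ d ⊖ b ⊗ c)       ≡⟨ 𝒪.solve (a ∷ b ∷ c ∷ d ∷ b′ ∷ []) ring ⟩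
      b′ ⊗ a ⊗ d ⊖ b ⊗ (b′ ⊗ c)  ≡⟨ cong (λ m → m ⊗ d ⊖ b ⊗ (b′ ⊗ c)) a′b≡b′a ⟨
      a′ ⊗ b ⊗ d ⊖ b ⊗ (b′ ⊗ c)  ≡⟨ 𝒪.solve (b ∷ c ∷ d ∷ a′ ∷ b′ ∷ []) ring ⟩
      b ⊗ (a′ ⊗ d ⊖ b′ ⊗ c)      ∎
    δ′≢0 : ¬ det a′ b′ c d ≡ 0ₒ
    δ′≢0 δ′≡0 = nonzero (⊗≡0⇒≡0 det≢0 a′ (vanishes a′ a a′δ≡aδ′) , ⊗≡0⇒≡0 det≢0 b′ (vanishes b′ b b′δ≡bδ′))
      where
      vanishes : ∀ u′ u → u′ ⊗ det a b c d ≡ u ⊗ det a′ b′ c d → u′ ⊗ det a b c d ≡ 0ₒ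
      vanishes u′ u eq = trans eq (trans (cong (u ⊗_) δ′≡0) (𝒪.solve (u ∷ []) ring))

  FareyPartner-respˡ : ∀ {a b} a′ b′ → FareyPartner a b →
                       a′ ⊗ b ≡ b′ ⊗ a → ¬ (a′ ≡ 0ₒ × b′ ≡ 0ₒ) → FareyPartner a′ b′
  FareyPartner-respˡ a′ b′ (c , d , q) a′b≡b′a nonzero = c , d , IsFareyQuadruple-respˡ a′ b′ q a′b≡b′a nonzero

  IsFareyQuadruple-sym : ∀ {a b c d} → IsFareyQuadruple a b c d → IsFareyQuadruple c d a b
  IsFareyQuadruple-sym {a} {b} {c} {d} q = record
    { det≢0  = λ δ′≡0 → det≢0 (trans det-swap (cong ⊝_ δ′≡0))
    ; det∣ac = swap-∣ a c det∣ac
    ; det∣ad = swap-∣ b c det∣bc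
    ; det∣bc = swap-∣ a d det∣ad
    ; det∣bd = swap-∣ b d det∣bd
    }
    where
    open IsFareyQuadruple q
    det-swap : a ⊗ d ⊖ b ⊗ c ≡ ⊝ (c ⊗ b ⊖ d ⊗ a)
    det-swap = 𝒪.solve (a ∷ b ∷ c ∷ d ∷ []) ring
    swap-∣ : ∀ x y → det a b c d ∣ x ⊗ y → det c d a b ∣ y ⊗ x
    swap-∣ x y δ∣xy = subst₂ _∣_ ⊝⊝δ′≡δ′ (⊗-comm x y) (⊝-∣ (subst (_∣ x ⊗ y) det-swap δ∣xy))
      where
      ⊝⊝δ′≡δ′ : ⊝ ⊝ (c ⊗ b ⊖ d ⊗ a) ≡ c ⊗ b ⊖ d ⊗ a
      ⊝⊝δ′≡δ′ = 𝒪.solve (a ∷ b ∷ c ∷ d ∷ []) ring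

  IsFareyQuadruple-swap : ∀ {a b c d} → IsFareyQuadruple b a c d → IsFareyQuadruple a b d c
  IsFareyQuadruple-swap {a} {b} {c} {d} q = record
    { det≢0  = λ δ′≡0 → det≢0 (trans det-swap (cong ⊝_ δ′≡0))
    ; det∣ac = swap-∣ det∣bd
    ; det∣ad = swap-∣ det∣bc
    ; det∣bc = swap-∣ det∣ad
    ; det∣bd = swap-∣ det∣ac
    }
    where
    open IsFareyQuadruple q
    det-swap : b ⊗ d ⊖ a ⊗ c ≡ ⊝ (a ⊗ c ⊖ b ⊗ d)
    det-swap = 𝒪.solve (a ∷ b ∷ c ∷ d ∷ []) ring
    swap-∣ : ∀ {z} → det b a c d ∣ z → det a b d c ∣ z
    swap-∣ {z} δ∣z = subst (_∣ z) ⊝⊝δ′≡δ′ (⊝-∣ (subst (_∣ z) det-swap δ∣z))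
      where
      ⊝⊝δ′≡δ′ : ⊝ ⊝ (a ⊗ c ⊖ b ⊗ d) ≡ a ⊗ c ⊖ b ⊗ d
      ⊝⊝δ′≡δ′ = 𝒪.solve (a ∷ b ∷ c ∷ d ∷ []) ring

  IsFareyQuadruple-nonzeroʳ : ∀ {a b c d} → IsFareyQuadruple a b c d → ¬ (c ≡ 0ₒ × d ≡ 0ₒ)
  IsFareyQuadruple-nonzeroʳ {a} {b} q (refl , refl) = IsFareyQuadruple.det≢0 q det-zero
    where
    det-zero : a ⊗ 0ₒ ⊖ b ⊗ 0ₒ ≡ 0ₒ
    det-zero = 𝒪.solve (a ∷ b ∷ []) ring

  det∣product : ∀ {a b c d} → IsFareyQuadruple a b c d →
                ∀ r s r′ s′ → det a b c d ∣ (r ⊗ a ⊕ s ⊗ b) ⊗ (r′ ⊗ c ⊕ s′ ⊗ d)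
  det∣product {a} {b} {c} {d} q r s r′ s′ = subst (det a b c d ∣_) expand
    (∣-⊕ (∣-⊕ (∣-⊗ʳ (r ⊗ r′) det∣ac) (∣-⊗ʳ (r ⊗ s′) det∣ad))
         (∣-⊕ (∣-⊗ʳ (s ⊗ r′) det∣bc) (∣-⊗ʳ (s ⊗ s′) det∣bd)))
    where
    open IsFareyQuadruple q
    expand : a ⊗ c ⊗ (r ⊗ r′) ⊕ a ⊗ d ⊗ (r ⊗ s′) ⊕ (b ⊗ c ⊗ (s ⊗ r′) ⊕ b ⊗ d ⊗ (s ⊗ s′))
             ≡ (r ⊗ a ⊕ s ⊗ b) ⊗ (r′ ⊗ c ⊕ s′ ⊗ d)
    expand = 𝒪.solve (a ∷ b ∷ c ∷ d ∷ r ∷ s ∷ r′ ∷ s′ ∷ []) ring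

  ⟦⟧⇒⊗ : ∀ {a b} z → ⟦ a ∣ b ⟧ z → ∃₂ λ r s → z ≡ r ⊗ a ⊕ s ⊗ b
  ⟦⟧⇒⊗ {a} {b} z (r , s , z≡) = r , s , trans z≡ (sym (cong₂ _+ₒ_ (⊗≡*ₒ r a) (⊗≡*ₒ s b)))

  ⊗⇒⟦⟧ : ∀ a b r s z → r ⊗ a ⊕ s ⊗ b ≡ z → ⟦ a ∣ b ⟧ z
  ⊗⇒⟦⟧ a b r s z eq = r , s , trans (sym eq) (cong₂ _+ₒ_ (⊗≡*ₒ r a) (⊗≡*ₒ s b))

  ⟦⟧-⊕ : ∀ a b x y → ⟦ a ∣ b ⟧ x → ⟦ a ∣ b ⟧ y → ⟦ a ∣ b ⟧ (x ⊕ y)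
  ⟦⟧-⊕ a b x y x∈ y∈ = combine (⟦⟧⇒⊗ x x∈) (⟦⟧⇒⊗ y y∈)
    where
    combine : (∃₂ λ r s → x ≡ r ⊗ a ⊕ s ⊗ b) → (∃₂ λ r s → y ≡ r ⊗ a ⊕ s ⊗ b) → ⟦ a ∣ b ⟧ (x ⊕ y)
    combine (r , s , x≡) (r′ , s′ , y≡) =
      ⊗⇒⟦⟧ a b (r ⊕ r′) (s ⊕ s′) (x ⊕ y) (trans (regroup r s r′ s′) (sym (cong₂ _⊕_ x≡ y≡)))
      where
      regroup : ∀ r s r′ s′ → (r ⊕ r′) ⊗ a ⊕ (s ⊕ s′) ⊗ b ≡ (r ⊗ a ⊕ s ⊗ b) ⊕ (r′ ⊗ a ⊕ s′ ⊗ b)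
      regroup r s r′ s′ = 𝒪.solve (r ∷ s ∷ r′ ∷ s′ ∷ a ∷ b ∷ []) ring

  ⟦⟧-⊗ : ∀ a b r x → ⟦ a ∣ b ⟧ x → ⟦ a ∣ b ⟧ (r ⊗ x)
  ⟦⟧-⊗ a b r x x∈ = scale (⟦⟧⇒⊗ x x∈)
    where
    scale : (∃₂ λ u v → x ≡ u ⊗ a ⊕ v ⊗ b) → ⟦ a ∣ b ⟧ (r ⊗ x)
    scale (u , v , x≡) = ⊗⇒⟦⟧ a b (r ⊗ u) (r ⊗ v) (r ⊗ x) (trans (regroup u v) (sym (cong (r ⊗_) x≡)))
      where
      regroup : ∀ u v → r ⊗ u ⊗ a ⊕ r ⊗ v ⊗ b ≡ r ⊗ (u ⊗ a ⊕ v ⊗ b)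
      regroup u v = 𝒪.solve (r ∷ u ∷ v ∷ a ∷ b ∷ []) ring

  ⟦⟧-generatorˡ : ∀ a b → ⟦ a ∣ b ⟧ a
  ⟦⟧-generatorˡ a b = ⊗⇒⟦⟧ a b 1ₒ 0ₒ a (𝒪.solve (a ∷ b ∷ []) ring)

  ⟦⟧-generatorʳ : ∀ a b → ⟦ a ∣ b ⟧ b
  ⟦⟧-generatorʳ a b = ⊗⇒⟦⟧ a b 0ₒ 1ₒ b (𝒪.solve (a ∷ b ∷ []) ring)

  det≡ : ∀ a b c d → det a b c d ≡ a *ₒ d -ₒ b *ₒ c
  det≡ a b c d = cong₂ (λ u v → u -ₒ v) (⊗≡*ₒ a d) (⊗≡*ₒ b c)

  det∣ideal-product : ∀ {a b c d} → IsFareyQuadruple a b c d →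
                      ∀ z → (⟦ a ∣ b ⟧ · ⟦ c ∣ d ⟧) z → det a b c d ∣ z
  det∣ideal-product {a} {b} {c} {d} q z (l , l⊆ , refl) = det∣sum l l⊆
    where
    det∣sum : ∀ l → All (λ p → ⟦ a ∣ b ⟧ (proj₁ p) × ⟦ c ∣ d ⟧ (proj₂ p)) l →
              det a b c d ∣ sumₒ (map (λ p → proj₁ p *ₒ proj₂ p) l)
    det∣sum [] All.[] = 0ₒ , 0∙δ≡0 (det a b c d)
      where
      0∙δ≡0 : ∀ δ → 0ₒ ⊗ δ ≡ 0ₒ
      0∙δ≡0 δ = 𝒪.solve (δ ∷ []) ring
    det∣sum ((i , j) ∷ l) ((i∈ , j∈) All.∷ l⊆) = ∣-⊕ (det∣ij (⟦⟧⇒⊗ i i∈) (⟦⟧⇒⊗ j j∈)) (det∣sum l l⊆)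
      where
      det∣ij : (∃₂ λ r s → i ≡ r ⊗ a ⊕ s ⊗ b) → (∃₂ λ r′ s′ → j ≡ r′ ⊗ c ⊕ s′ ⊗ d) → det a b c d ∣ i *ₒ j
      det∣ij (r , s , refl) (r′ , s′ , refl) =
        subst (det a b c d ∣_) (⊗≡*ₒ (r ⊗ a ⊕ s ⊗ b) (r′ ⊗ c ⊕ s′ ⊗ d)) (det∣product q r s r′ s′)

  ideal-product : ∀ {a b c d} → IsFareyQuadruple a b c d →
                  (⟦ a ∣ b ⟧ · ⟦ c ∣ d ⟧) ≐ ⟨ a *ₒ d -ₒ b *ₒ c ⟩
  ideal-product {a} {b} {c} {d} q z = to , from
    where
    open ≡-Reasoning
    to : (⟦ a ∣ b ⟧ · ⟦ c ∣ d ⟧) z → ⟨ a *ₒ d -ₒ b *ₒ c ⟩ z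
    to z∈ = quotient-is-coefficient (det∣ideal-product q z z∈)
      where
      quotient-is-coefficient : det a b c d ∣ z → ⟨ a *ₒ d -ₒ b *ₒ c ⟩ z
      quotient-is-coefficient (r , rδ≡z) = r , (begin
        z                          ≡⟨ rδ≡z ⟨
        r ⊗ det a b c d            ≡⟨ ⊗≡*ₒ r (det a b c d) ⟩
        r *ₒ det a b c d           ≡⟨ cong (r *ₒ_) (det≡ a b c d) ⟩
        r *ₒ (a *ₒ d -ₒ b *ₒ c)    ∎)
    from : ⟨ a *ₒ d -ₒ b *ₒ c ⟩ z → (⟦ a ∣ b ⟧ · ⟦ c ∣ d ⟧) z
    from (r , refl) =
      (r ⊗ a , d) ∷ (⊝ (r ⊗ b) , c) ∷ [] ,
      (⊗⇒⟦⟧ a b r 0ₒ (r ⊗ a) (𝒪.solve (a ∷ b ∷ r ∷ []) ring) ,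
       ⊗⇒⟦⟧ c d 0ₒ 1ₒ d (𝒪.solve (c ∷ d ∷ []) ring)) All.∷
      (⊗⇒⟦⟧ a b 0ₒ (⊝ r) (⊝ (r ⊗ b)) (𝒪.solve (a ∷ b ∷ r ∷ []) ring) ,
       ⊗⇒⟦⟧ c d 1ₒ 0ₒ c (𝒪.solve (c ∷ d ∷ []) ring)) All.∷ All.[] ,
      (begin
        r *ₒ (a *ₒ d -ₒ b *ₒ c)                  ≡⟨ cong (r *ₒ_) (det≡ a b c d) ⟨
        r *ₒ det a b c d                         ≡⟨ ⊗≡*ₒ r (det a b c d) ⟨
        r ⊗ (a ⊗ d ⊖ b ⊗ c)                      ≡⟨ 𝒪.solve (a ∷ b ∷ c ∷ d ∷ r ∷ []) ring ⟩
        r ⊗ a ⊗ d ⊕ (⊝ (r ⊗ b) ⊗ c ⊕ 0ₒ)         ≡⟨ cong₂ _+ₒ_ (⊗≡*ₒ (r ⊗ a) d) (cong (_+ₒ 0ₒ) (⊗≡*ₒ (⊝ (r ⊗ b)) c)) ⟩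
        (r ⊗ a) *ₒ d +ₒ ((⊝ (r ⊗ b)) *ₒ c +ₒ 0ₒ) ∎)

  -- The hypotheses say that (a, b) = (e, β) and (e, β)(e, γ) = (e).
  module FromInverse (a b e β γ κ U V W : 𝒪) (e≢0 : ¬ e ≡ 0ₒ)
                     (e∈ : ⟦ a ∣ b ⟧ e) (β∈ : ⟦ a ∣ b ⟧ β) (e∣a : e ∣ a) (b∈ : ⟦ β ∣ e ⟧ b)
                     (βγ≡κe : β ⊗ γ ≡ κ ⊗ e) (unit : U ⊗ e ⊕ V ⊗ (β ⊕ γ) ⊕ W ⊗ κ ≡ 1ₒ) where
    open ≡-Reasoning

    j₁ j₂ : 𝒪
    j₁ = U ⊗ e ⊕ V ⊗ γ
    j₂ = V ⊗ e ⊕ W ⊗ γ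

    ej₁+βj₂≡e : e ⊗ j₁ ⊕ β ⊗ j₂ ≡ e
    ej₁+βj₂≡e = begin
      e ⊗ (U ⊗ e ⊕ V ⊗ γ) ⊕ β ⊗ (V ⊗ e ⊕ W ⊗ γ)  ≡⟨ 𝒪.solve (e ∷ β ∷ γ ∷ U ∷ V ∷ W ∷ []) ring ⟩
      e ⊗ (U ⊗ e ⊕ V ⊗ (β ⊕ γ)) ⊕ W ⊗ (β ⊗ γ)    ≡⟨ cong (λ m → e ⊗ (U ⊗ e ⊕ V ⊗ (β ⊕ γ)) ⊕ W ⊗ m) βγ≡κe ⟩
      e ⊗ (U ⊗ e ⊕ V ⊗ (β ⊕ γ)) ⊕ W ⊗ (κ ⊗ e)    ≡⟨ 𝒪.solve (e ∷ β ∷ γ ∷ κ ∷ U ∷ V ∷ W ∷ []) ring ⟩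
      e ⊗ (U ⊗ e ⊕ V ⊗ (β ⊕ γ) ⊕ W ⊗ κ)          ≡⟨ cong (e ⊗_) unit ⟩
      e ⊗ 1ₒ                                     ≡⟨ 𝒪.solve (e ∷ []) ring ⟩
      e                                          ∎

    e∣β⊗span : ∀ r s → e ∣ β ⊗ (r ⊗ j₁ ⊕ s ⊗ j₂)
    e∣β⊗span r s = r ⊗ (U ⊗ β ⊕ V ⊗ κ) ⊕ s ⊗ (V ⊗ β ⊕ W ⊗ κ) , (begin
      (r ⊗ (U ⊗ β ⊕ V ⊗ κ) ⊕ s ⊗ (V ⊗ β ⊕ W ⊗ κ)) ⊗ e
        ≡⟨ 𝒪.solve (r ∷ s ∷ U ∷ V ∷ W ∷ β ∷ κ ∷ e ∷ []) ring ⟩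
      β ⊗ (r ⊗ (U ⊗ e) ⊕ s ⊗ (V ⊗ e)) ⊕ (r ⊗ V ⊕ s ⊗ W) ⊗ (κ ⊗ e)
        ≡⟨ cong (λ m → β ⊗ (r ⊗ (U ⊗ e) ⊕ s ⊗ (V ⊗ e)) ⊕ (r ⊗ V ⊕ s ⊗ W) ⊗ m) βγ≡κe ⟨
      β ⊗ (r ⊗ (U ⊗ e) ⊕ s ⊗ (V ⊗ e)) ⊕ (r ⊗ V ⊕ s ⊗ W) ⊗ (β ⊗ γ)
        ≡⟨ 𝒪.solve (r ∷ s ∷ U ∷ V ∷ W ∷ β ∷ γ ∷ e ∷ []) ring ⟩
      β ⊗ (r ⊗ (U ⊗ e ⊕ V ⊗ γ) ⊕ s ⊗ (V ⊗ e ⊕ W ⊗ γ))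
        ∎)

    e∣b⊗span : ∀ r s → e ∣ b ⊗ (r ⊗ j₁ ⊕ s ⊗ j₂)
    e∣b⊗span r s = via-β (⟦⟧⇒⊗ b b∈)
      where
      j : 𝒪
      j = r ⊗ j₁ ⊕ s ⊗ j₂
      via-β : (∃₂ λ q E → b ≡ q ⊗ β ⊕ E ⊗ e) → e ∣ b ⊗ j
      via-β (q , E , b≡) = subst (e ∣_) (trans (expand j) (cong (_⊗ j) (sym b≡)))
                                 (∣-⊕ (∣-⊗ʳ q (e∣β⊗span r s)) (E ⊗ j , refl))
        where
        expand : ∀ j → β ⊗ j ⊗ q ⊕ E ⊗ j ⊗ e ≡ (q ⊗ β ⊕ E ⊗ e) ⊗ j
        expand j = 𝒪.solve (q ∷ E ∷ β ∷ e ∷ j ∷ []) ring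

    partner : FareyPartner a b
    partner = decompose (⟦⟧⇒⊗ e e∈) (⟦⟧⇒⊗ β β∈)
      where
      decompose : (∃₂ λ P Q → e ≡ P ⊗ a ⊕ Q ⊗ b) → (∃₂ λ R S → β ≡ R ⊗ a ⊕ S ⊗ b) → FareyPartner a b
      decompose (P , Q , e≡) (R , S , β≡) = c , d , record
        { det≢0  = λ δ≡0 → e≢0 (trans (sym det≡e) δ≡0)
        ; det∣ac = subst (_∣ a ⊗ c) (sym det≡e) (∣-⊗ʳ c e∣a)
        ; det∣ad = subst (_∣ a ⊗ d) (sym det≡e) (∣-⊗ʳ d e∣a)
        ; det∣bc = subst (_∣ b ⊗ c) (sym det≡e) (e∣b⊗span (⊝ Q) (⊝ S))
        ; det∣bd = subst (_∣ b ⊗ d) (sym det≡e) (e∣b⊗span P R)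
        }
        where
        c d : 𝒪
        c = ⊝ Q ⊗ j₁ ⊕ ⊝ S ⊗ j₂
        d = P ⊗ j₁ ⊕ R ⊗ j₂
        collect : ∀ j₁ j₂ → a ⊗ (P ⊗ j₁ ⊕ R ⊗ j₂) ⊖ b ⊗ (⊝ Q ⊗ j₁ ⊕ ⊝ S ⊗ j₂)
                           ≡ (P ⊗ a ⊕ Q ⊗ b) ⊗ j₁ ⊕ (R ⊗ a ⊕ S ⊗ b) ⊗ j₂
        collect j₁ j₂ = 𝒪.solve (a ∷ b ∷ P ∷ Q ∷ R ∷ S ∷ j₁ ∷ j₂ ∷ []) ring
        det≡e : a ⊗ d ⊖ b ⊗ c ≡ e
        det≡e = begin
          a ⊗ d ⊖ b ⊗ c                                ≡⟨ collect j₁ j₂ ⟩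
          (P ⊗ a ⊕ Q ⊗ b) ⊗ j₁ ⊕ (R ⊗ a ⊕ S ⊗ b) ⊗ j₂  ≡⟨ cong₂ (λ u v → u ⊗ j₁ ⊕ v ⊗ j₂) e≡ β≡ ⟨
          e ⊗ j₁ ⊕ β ⊗ j₂                              ≡⟨ ej₁+βj₂≡e ⟩
          e                                            ∎

  ~⇒⊗ : ∀ x y → x ~ y → num x ⊗ den y ≡ den x ⊗ num y
  ~⇒⊗ x y x~y = trans (⊗≡*ₒ (num x) (den y)) (trans x~y (sym (⊗≡*ₒ (den x) (num y))))

  ~-dec : ∀ x y → Dec (x ~ y)
  ~-dec x y = (num x *ₒ den y) ≟ₒ (den x *ₒ num y)

  ~-euclidean : ∀ u v w → u ~ w → v ~ w → u ~ v
  ~-euclidean u@(nu / du ∶ _) v@(nv / dv ∶ _) w@(nw / dw ∶ w≢0) u~w v~w =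
    [ ⊗-form , (λ nw≡0 → [ ⊗-form , (λ dw≡0 → ⊥-elim (w≢0 (nw≡0 , dw≡0))) ]′
                            (⊗-zero-divisor Δ (den w) Δ⊗dw≡0)) ]′
      (⊗-zero-divisor Δ (num w) Δ⊗nw≡0)
    where
    open ≡-Reasoning
    Δ : 𝒪
    Δ = nu ⊗ dv ⊖ du ⊗ nv
    ⊗-form : Δ ≡ 0ₒ → u ~ v
    ⊗-form Δ≡0 = trans (sym (⊗≡*ₒ nu dv)) (trans (⊖≡0⇒≡ (nu ⊗ dv) (du ⊗ nv) Δ≡0) (⊗≡*ₒ du nv))
    Δ⊗nw≡0 : Δ ⊗ nw ≡ 0ₒ
    Δ⊗nw≡0 = begin
      (nu ⊗ dv ⊖ du ⊗ nv) ⊗ nw        ≡⟨ 𝒪.solve (nu ∷ du ∷ nv ∷ dv ∷ nw ∷ []) ring ⟩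
      nu ⊗ (dv ⊗ nw) ⊖ du ⊗ nw ⊗ nv   ≡⟨ cong₂ (λ p q → nu ⊗ p ⊖ q ⊗ nv) (~⇒⊗ v w v~w) (~⇒⊗ u w u~w) ⟨
      nu ⊗ (nv ⊗ dw) ⊖ nu ⊗ dw ⊗ nv   ≡⟨ 𝒪.solve (nu ∷ nv ∷ dw ∷ []) ring ⟩
      0ₒ                              ∎
    Δ⊗dw≡0 : Δ ⊗ dw ≡ 0ₒ
    Δ⊗dw≡0 = begin
      (nu ⊗ dv ⊖ du ⊗ nv) ⊗ dw        ≡⟨ 𝒪.solve (nu ∷ du ∷ nv ∷ dv ∷ dw ∷ []) ring ⟩
      nu ⊗ dw ⊗ dv ⊖ du ⊗ (nv ⊗ dw)   ≡⟨ cong₂ (λ p q → p ⊗ dv ⊖ du ⊗ q) (~⇒⊗ u w u~w) (~⇒⊗ v w v~w) ⟩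
      du ⊗ nw ⊗ dv ⊖ du ⊗ (dv ⊗ nw)   ≡⟨ 𝒪.solve (du ∷ dv ∷ nw ∷ []) ring ⟩
      0ₒ                              ∎

  farey-neighbours : ∀ x y → IsFareyQuadruple (num x) (den x) (num y) (den y) → FareyNeighbours x y
  farey-neighbours x y q = distinct , λ x′ y′ x′~x y′~y → ideal-product (respects x′ y′ x′~x y′~y)
    where
    distinct : ¬ x ~ y
    distinct x~y = IsFareyQuadruple.det≢0 q (≡⇒⊖≡0 _ _ (~⇒⊗ x y x~y))
    respects : ∀ x′ y′ → x′ ~ x → y′ ~ y → IsFareyQuadruple (num x′) (den x′) (num y′) (den y′)
    respects x′ y′ x′~x y′~y =
      IsFareyQuadruple-sym (IsFareyQuadruple-respˡ (num y′) (den y′)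
        (IsFareyQuadruple-sym (IsFareyQuadruple-respˡ (num x′) (den x′) q (~⇒⊗ x′ x x′~x) (nonzero x′)))
        (~⇒⊗ y′ y y′~y) (nonzero y′))

  IsFareyQuadruple-shift : ∀ {a b c d} → IsFareyQuadruple a b c d → ∀ κ →
    IsFareyQuadruple a b (c ⊕ κ ⊗ det a b c d ⊗ a) (d ⊕ κ ⊗ det a b c d ⊗ b)
  IsFareyQuadruple-shift {a} {b} {c} {d} q κ = record
    { det≢0  = λ δ′≡0 → det≢0 (trans (sym (det-shift δ)) δ′≡0)
    ; det∣ac = shift-∣ a c a det∣ac
    ; det∣ad = shift-∣ a d b det∣ad
    ; det∣bc = shift-∣ b c a det∣bc
    ; det∣bd = shift-∣ b d b det∣bd
    }
    where
    open IsFareyQuadruple q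
    δ : 𝒪
    δ = det a b c d
    det-shift : ∀ δ → a ⊗ (d ⊕ κ ⊗ δ ⊗ b) ⊖ b ⊗ (c ⊕ κ ⊗ δ ⊗ a) ≡ a ⊗ d ⊖ b ⊗ c
    det-shift δ = 𝒪.solve (a ∷ b ∷ c ∷ d ∷ κ ∷ δ ∷ []) ring
    shift-∣ : ∀ u v w → δ ∣ u ⊗ v → det a b (c ⊕ κ ⊗ δ ⊗ a) (d ⊕ κ ⊗ δ ⊗ b) ∣ u ⊗ (v ⊕ κ ⊗ δ ⊗ w)
    shift-∣ u v w δ∣uv = subst₂ _∣_ (sym (det-shift δ)) (expand u v w δ) (∣-⊕ δ∣uv (κ ⊗ u ⊗ w , refl))
      where
      expand : ∀ u v w δ → u ⊗ v ⊕ κ ⊗ u ⊗ w ⊗ δ ≡ u ⊗ (v ⊕ κ ⊗ δ ⊗ w)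
      expand u v w δ = 𝒪.solve (u ∷ v ∷ w ∷ κ ∷ δ ∷ []) ring

  shift-injective : ∀ {a b c d} → IsFareyQuadruple a b c d → ∀ κ μ →
    let δ = det a b c d in
    (c ⊕ κ ⊗ δ ⊗ a) ⊗ (d ⊕ μ ⊗ δ ⊗ b) ≡ (d ⊕ κ ⊗ δ ⊗ b) ⊗ (c ⊕ μ ⊗ δ ⊗ a) → κ ≡ μ
  shift-injective {a} {b} {c} {d} q κ μ cross =
    ⊖≡0⇒≡ κ μ (⊗≡0⇒≡0 det≢0 (κ ⊖ μ) (⊗≡0⇒≡0 det≢0 ((κ ⊖ μ) ⊗ det a b c d)
      (trans (sym cross-difference) (≡⇒⊖≡0 _ _ cross))))
    where
    open IsFareyQuadruple q
    cross-difference :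
      (c ⊕ κ ⊗ (a ⊗ d ⊖ b ⊗ c) ⊗ a) ⊗ (d ⊕ μ ⊗ (a ⊗ d ⊖ b ⊗ c) ⊗ b)
        ⊖ (d ⊕ κ ⊗ (a ⊗ d ⊖ b ⊗ c) ⊗ b) ⊗ (c ⊕ μ ⊗ (a ⊗ d ⊖ b ⊗ c) ⊗ a)
      ≡ (κ ⊖ μ) ⊗ (a ⊗ d ⊖ b ⊗ c) ⊗ (a ⊗ d ⊖ b ⊗ c)
    cross-difference = 𝒪.solve (a ∷ b ∷ c ∷ d ∷ κ ∷ μ ∷ []) ring

  infinitely-many-neighbours : ∀ x → FareyPartner (num x) (den x) → InfiniteP1 (FareyNeighbours x)
  infinitely-many-neighbours x (c , d , q) L =
    let k , escapes = injective-family-escapes ~-dec ~-euclidean neighbour neighbour-injective L in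
    neighbour k , farey-neighbours x (neighbour k) (IsFareyQuadruple-shift q (κ k)) , escapes
    where
    a b : 𝒪
    a = num x
    b = den x
    κ : ℕ → 𝒪
    κ k = ι (+ k)
    neighbour : ℕ → Rep
    neighbour k = (c ⊕ κ k ⊗ det a b c d ⊗ a) / (d ⊕ κ k ⊗ det a b c d ⊗ b)
                  ∶ IsFareyQuadruple-nonzeroʳ (IsFareyQuadruple-shift q (κ k))
    neighbour-injective : ∀ k j → neighbour k ~ neighbour j → k ≡ j
    neighbour-injective k j k~j =
      ℤ.+-injective (cong re (shift-injective q (κ k) (κ j) (~⇒⊗ (neighbour k) (neighbour j) k~j)))

-- Existence of Farey partners

-- N (f + ω) = f (f + t) + n and Tr (f + ω) = f + (f + t). This is the only consequence of
-- D being squarefree (i.e. of 𝒪 being the maximal order) that the argument needs.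
NormTraceCoprime : ℤ → ℤ → Set
NormTraceCoprime t n = ∀ e f k → e ℤ.* k ≡ f ℤ.* (f ℤ.+ t) ℤ.+ n →
                       ∀ g → + g ℤ∣.∣ e → + g ℤ∣.∣ f ℤ.+ (f ℤ.+ t) → + g ℤ∣.∣ k → g ≡ 1

module PartnerExistence (D : ℕ) (N≡0⇒≡0 : ∀ x → QuadraticRing.N D x ≡ + 0 → x ≡ QuadInt.0ₒ D)
                        (coprime : NormTraceCoprime (QuadInt.t D) (QuadInt.n D)) where
  open QuadInt D
  open QuadraticRing D
  open FareyQuadruples D N≡0⇒≡0

  -- β = xω · A + ((z − t y) + yω) · b, and (A, b) = (e, β) for e = gcd(A, E₂, N β).
  module Primitive (A p q x y z : ℤ) (A≢0 : ¬ A ≡ + 0)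
                   (xA+yp+zq≡1 : x ℤ.* A ℤ.+ y ℤ.* p ℤ.+ z ℤ.* q ≡ + 1) where
    a b : 𝒪
    a = ι A
    b = p + q ω

    f : ℤ
    f = (z ℤ.- t ℤ.* y) ℤ.* p ℤ.- y ℤ.* q ℤ.* n

    β : 𝒪
    β = f + (+ 1) ω

    β∈ : ⟦ a ∣ b ⟧ β
    β∈ = ⊗⇒⟦⟧ a b ((+ 0) + x ω) ((z ℤ.- t ℤ.* y) + y ω) β
           (cong₂ _+_ω (re-β t n A p q x y z) (trans (im-β t n A p q x y z) xA+yp+zq≡1))
      where
      re-β : ∀ t n A p q x y z → + 0 ℤ.* A ℤ.- x ℤ.* + 0 ℤ.* n ℤ.+ ((z ℤ.- t ℤ.* y) ℤ.* p ℤ.- y ℤ.* q ℤ.* n)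
                                 ≡ (z ℤ.- t ℤ.* y) ℤ.* p ℤ.- y ℤ.* q ℤ.* n
      re-β = solve-∀
      im-β : ∀ t n A p q x y z → + 0 ℤ.* + 0 ℤ.+ x ℤ.* A ℤ.+ x ℤ.* + 0 ℤ.* t
                                   ℤ.+ ((z ℤ.- t ℤ.* y) ℤ.* q ℤ.+ y ℤ.* p ℤ.+ y ℤ.* q ℤ.* t)
                                 ≡ x ℤ.* A ℤ.+ y ℤ.* p ℤ.+ z ℤ.* q
      im-β = solve-∀

    E₂ : ℤ
    E₂ = p ℤ.- q ℤ.* f

    b≡qβ+E₂ : b ≡ ι q ⊗ β ⊕ ι E₂
    b≡qβ+E₂ = cong₂ _+_ω (re-b t n p q f) (im-b t n q f)
      where
      re-b : ∀ t n p q f → p ≡ q ℤ.* f ℤ.- + 0 ℤ.* + 1 ℤ.* n ℤ.+ (p ℤ.- q ℤ.* f)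
      re-b = solve-∀
      im-b : ∀ t n q f → q ≡ q ℤ.* + 1 ℤ.+ + 0 ℤ.* f ℤ.+ + 0 ℤ.* + 1 ℤ.* t ℤ.+ + 0
      im-b = solve-∀

    E₂∈ : ⟦ a ∣ b ⟧ (ι E₂)
    E₂∈ = subst ⟦ a ∣ b ⟧ (trans (cong (_⊕ ⊝ ι q ⊗ β) b≡qβ+E₂) (cancel (ι q) β (ι E₂)))
            (⟦⟧-⊕ a b b (⊝ ι q ⊗ β) (⟦⟧-generatorʳ a b) (⟦⟧-⊗ a b (⊝ ι q) β β∈))
      where
      cancel : ∀ Q β E → Q ⊗ β ⊕ E ⊕ ⊝ Q ⊗ β ≡ E
      cancel Q β E = 𝒪.solve (Q ∷ β ∷ E ∷ []) ring

    Nβ∈ : ⟦ a ∣ b ⟧ (ι (N β))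
    Nβ∈ = subst ⟦ a ∣ b ⟧ (conj-⊗ β) (⟦⟧-⊗ a b (conj β) β β∈)

    open Bézout₃ (bézout₃-ℤ A E₂ (N β)) using ()
      renaming (gcd to e; x to u; y to v; z to w; identity to uA+vE₂+wNβ≡e;
                gcd∣i to e∣A; gcd∣j to e∣E₂; gcd∣k to e∣Nβ)
    open ℤ∣._∣_ e∣A using () renaming (quotient to A′; equality to A≡A′e)
    open ℤ∣._∣_ e∣E₂ using () renaming (quotient to E₂′; equality to E₂≡E₂′e)
    open ℤ∣._∣_ e∣Nβ using () renaming (quotient to k; equality to Nβ≡ke)

    e≢0 : ¬ ι (+ e) ≡ 0ₒ
    e≢0 ιe≡0 = A≢0 (trans A≡A′e (trans (cong (A′ ℤ.*_) (cong re ιe≡0)) (ℤ.*-zeroʳ A′)))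

    e∈ : ⟦ a ∣ b ⟧ (ι (+ e))
    e∈ = subst ⟦ a ∣ b ⟧ ι-combination
           (⟦⟧-⊕ a b _ _ (⟦⟧-⊕ a b _ _ (⟦⟧-⊗ a b (ι u) a (⟦⟧-generatorˡ a b)) (⟦⟧-⊗ a b (ι v) (ι E₂) E₂∈))
                         (⟦⟧-⊗ a b (ι w) (ι (N β)) Nβ∈))
      where
      ι-combination : ι u ⊗ a ⊕ ι v ⊗ ι E₂ ⊕ ι w ⊗ ι (N β) ≡ ι (+ e)
      ι-combination = trans (sym (cong₂ _⊕_ (cong₂ _⊕_ (ι-⊗ u A) (ι-⊗ v E₂)) (ι-⊗ w (N β))))
                            (cong ι uA+vE₂+wNβ≡e)

    e∣a : ι (+ e) ∣ a
    e∣a = ι A′ , trans (sym (ι-⊗ A′ (+ e))) (cong ι (sym A≡A′e))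

    b∈ : ⟦ β ∣ ι (+ e) ⟧ b
    b∈ = ⊗⇒⟦⟧ β (ι (+ e)) (ι q) (ι E₂′) b
           (trans (cong (ι q ⊗ β ⊕_) (trans (sym (ι-⊗ E₂′ (+ e))) (cong ι (sym E₂≡E₂′e)))) (sym b≡qβ+E₂))

    β⊗conjβ : β ⊗ conj β ≡ ι k ⊗ ι (+ e)
    β⊗conjβ = trans (⊗-comm β (conj β)) (trans (conj-⊗ β) (trans (cong ι Nβ≡ke) (ι-⊗ k (+ e))))

    β⊕conjβ : β ⊕ conj β ≡ ι (f ℤ.+ (f ℤ.+ t))
    β⊕conjβ = cong (λ m → (f ℤ.+ (f ℤ.+ m)) + (+ 0) ω) (ℤ.*-identityʳ t)

    ek≡Nβ : + e ℤ.* k ≡ f ℤ.* (f ℤ.+ t) ℤ.+ n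
    ek≡Nβ = trans (ℤ.*-comm (+ e) k) (trans (sym Nβ≡ke) (norm-β t n f))
      where
      norm-β : ∀ t n f → f ℤ.* f ℤ.+ t ℤ.* (f ℤ.* + 1) ℤ.+ n ℤ.* (+ 1 ℤ.* + 1) ≡ f ℤ.* (f ℤ.+ t) ℤ.+ n
      norm-β = solve-∀

    open Bézout₃ (bézout₃-ℤ (+ e) (f ℤ.+ (f ℤ.+ t)) k) using ()
      renaming (gcd to g; x to U; y to V; z to W; identity to Ue+Vtr+Wk≡g;
                gcd∣i to g∣e; gcd∣j to g∣tr; gcd∣k to g∣k)

    unit : ι U ⊗ ι (+ e) ⊕ ι V ⊗ (β ⊕ conj β) ⊕ ι W ⊗ ι k ≡ 1ₒ
    unit = begin
      ι U ⊗ ι (+ e) ⊕ ι V ⊗ (β ⊕ conj β) ⊕ ι W ⊗ ι k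
        ≡⟨ cong (λ m → ι U ⊗ ι (+ e) ⊕ ι V ⊗ m ⊕ ι W ⊗ ι k) β⊕conjβ ⟩
      ι U ⊗ ι (+ e) ⊕ ι V ⊗ ι (f ℤ.+ (f ℤ.+ t)) ⊕ ι W ⊗ ι k
        ≡⟨ cong₂ _⊕_ (cong₂ _⊕_ (ι-⊗ U (+ e)) (ι-⊗ V (f ℤ.+ (f ℤ.+ t)))) (ι-⊗ W k) ⟨
      ι (U ℤ.* + e ℤ.+ V ℤ.* (f ℤ.+ (f ℤ.+ t)) ℤ.+ W ℤ.* k)
        ≡⟨ cong ι (trans Ue+Vtr+Wk≡g (cong +_ (coprime (+ e) f k ek≡Nβ g g∣e g∣tr g∣k))) ⟩
      1ₒ ∎
      where open ≡-Reasoning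

    partner : FareyPartner a b
    partner = FromInverse.partner a b (ι (+ e)) β (conj β) (ι k) (ι U) (ι V) (ι W)
                                  e≢0 e∈ β∈ e∣a b∈ β⊗conjβ unit

  partner-ι : ∀ A p q → ¬ A ≡ + 0 → FareyPartner (ι A) (p + q ω)
  partner-ι A p q A≢0 =
    FareyPartner-respˡ (ι A) (p + q ω) (Primitive.partner A′ p′ q′ x y z A′≢0 xA′+yp′+zq′≡1)
                       proportional (λ (ιA≡0 , _) → A≢0 (cong re ιA≡0))
    where
    open Bézout₃ (bézout₃-ℤ A p q) using (x; y; z)
      renaming (gcd to g; identity to xA+yp+zq≡g; gcd∣i to g∣A; gcd∣j to g∣p; gcd∣k to g∣q)
    open ℤ∣._∣_ g∣A using () renaming (quotient to A′; equality to A≡A′g)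
    open ℤ∣._∣_ g∣p using () renaming (quotient to p′; equality to p≡p′g)
    open ℤ∣._∣_ g∣q using () renaming (quotient to q′; equality to q≡q′g)

    A′≢0 : ¬ A′ ≡ + 0
    A′≢0 A′≡0 = A≢0 (trans A≡A′g (cong (ℤ._* + g) A′≡0))

    g≢0 : ¬ + g ≡ + 0
    g≢0 g≡0 = A≢0 (trans A≡A′g (trans (cong (A′ ℤ.*_) g≡0) (ℤ.*-zeroʳ A′)))

    xA′+yp′+zq′≡1 : x ℤ.* A′ ℤ.+ y ℤ.* p′ ℤ.+ z ℤ.* q′ ≡ + 1
    xA′+yp′+zq′≡1 = ℤ.*-cancelʳ-≡ _ (+ 1) (+ g) {{ℤ.≢-nonZero g≢0}} (begin
      (x ℤ.* A′ ℤ.+ y ℤ.* p′ ℤ.+ z ℤ.* q′) ℤ.* + g      ≡⟨ distribute x y z A′ p′ q′ (+ g) ⟩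
      x ℤ.* (A′ ℤ.* + g) ℤ.+ y ℤ.* (p′ ℤ.* + g) ℤ.+ z ℤ.* (q′ ℤ.* + g)
        ≡⟨ cong₂ (λ u v → x ℤ.* u ℤ.+ y ℤ.* v ℤ.+ z ℤ.* (q′ ℤ.* + g)) A≡A′g p≡p′g ⟨
      x ℤ.* A ℤ.+ y ℤ.* p ℤ.+ z ℤ.* (q′ ℤ.* + g)       ≡⟨ cong (λ u → x ℤ.* A ℤ.+ y ℤ.* p ℤ.+ z ℤ.* u) q≡q′g ⟨
      x ℤ.* A ℤ.+ y ℤ.* p ℤ.+ z ℤ.* q                  ≡⟨ xA+yp+zq≡g ⟩
      + g                                              ≡⟨ ℤ.*-identityˡ (+ g) ⟨
      + 1 ℤ.* + g                                      ∎)
      where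
      open ≡-Reasoning
      distribute : ∀ x y z A p q g → (x ℤ.* A ℤ.+ y ℤ.* p ℤ.+ z ℤ.* q) ℤ.* g
                                     ≡ x ℤ.* (A ℤ.* g) ℤ.+ y ℤ.* (p ℤ.* g) ℤ.+ z ℤ.* (q ℤ.* g)
      distribute = solve-∀

    proportional : ι A ⊗ (p′ + q′ ω) ≡ (p + q ω) ⊗ ι A′
    proportional = begin
      ι A ⊗ (p′ + q′ ω)                      ≡⟨ cong (_⊗ (p′ + q′ ω)) (trans (cong ι A≡A′g) (ι-⊗ A′ (+ g))) ⟩
      ι A′ ⊗ ι (+ g) ⊗ (p′ + q′ ω)           ≡⟨ reorder (ι A′) (ι (+ g)) (p′ + q′ ω) ⟩
      ι (+ g) ⊗ (p′ + q′ ω) ⊗ ι A′           ≡⟨ cong (_⊗ ι A′) (ι-scale (+ g) p′ q′) ⟩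
      (+ g ℤ.* p′) + (+ g ℤ.* q′) ω ⊗ ι A′   ≡⟨ cong (_⊗ ι A′) (cong₂ _+_ω (trans (ℤ.*-comm (+ g) p′) (sym p≡p′g))
                                                                     (trans (ℤ.*-comm (+ g) q′) (sym q≡q′g))) ⟩
      (p + q ω) ⊗ ι A′                       ∎
      where
      open ≡-Reasoning
      reorder : ∀ α γ β → α ⊗ γ ⊗ β ≡ γ ⊗ β ⊗ α
      reorder α γ β = 𝒪.solve (α ∷ γ ∷ β ∷ []) ring

  partner-exists : ∀ a b → ¬ (a ≡ 0ₒ × b ≡ 0ₒ) → FareyPartner a b
  partner-exists a b nonzero = by-cases (a ≟ₒ 0ₒ)
    where
    partner-of-nonzero : ∀ a b → ¬ a ≡ 0ₒ → FareyPartner a b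
    partner-of-nonzero a b a≢0 =
      FareyPartner-respˡ a b (partner-ι (N a) (re (conj a ⊗ b)) (im (conj a ⊗ b)) (λ Na≡0 → a≢0 (N≡0⇒≡0 a Na≡0)))
                         (trans (rescale a b (conj a)) (cong (b ⊗_) (conj-⊗ a))) (λ (a≡0 , _) → a≢0 a≡0)
      where
      rescale : ∀ a b γ → a ⊗ (γ ⊗ b) ≡ b ⊗ (γ ⊗ a)
      rescale a b γ = 𝒪.solve (a ∷ b ∷ γ ∷ []) ring
    by-cases : Dec (a ≡ 0ₒ) → FareyPartner a b
    by-cases (no a≢0) = partner-of-nonzero a b a≢0
    by-cases (yes a≡0) =
      let c , d , q = partner-of-nonzero b a (λ b≡0 → nonzero (a≡0 , b≡0)) in d , c , IsFareyQuadruple-swap q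

-- The norm form and the discriminant

i*i≡∣i∣*∣i∣ : ∀ i → i ℤ.* i ≡ + (∣ i ∣ ℕ.* ∣ i ∣)
i*i≡∣i∣*∣i∣ (+ m)      = sym (ℤ.pos-* m m)
i*i≡∣i∣*∣i∣ ℤ.-[1+ m ] = refl

square-plus-positive≡0 : ∀ u v m → u ℤ.* u ℤ.+ + suc m ℤ.* (v ℤ.* v) ≡ + 0 → u ≡ + 0 × v ≡ + 0
square-plus-positive≡0 u v m eq = square≡0 u ∣u∣²≡0 , square≡0 v ∣v∣²≡0
  where
  in-ℕ : ∣ u ∣ ℕ.* ∣ u ∣ ℕ.+ suc m ℕ.* (∣ v ∣ ℕ.* ∣ v ∣) ≡ 0
  in-ℕ = ℤ.+-injective (begin
    + (∣ u ∣ ℕ.* ∣ u ∣ ℕ.+ suc m ℕ.* (∣ v ∣ ℕ.* ∣ v ∣))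
      ≡⟨ ℤ.pos-+ (∣ u ∣ ℕ.* ∣ u ∣) _ ⟩
    + (∣ u ∣ ℕ.* ∣ u ∣) ℤ.+ + (suc m ℕ.* (∣ v ∣ ℕ.* ∣ v ∣))
      ≡⟨ cong (λ p → + (∣ u ∣ ℕ.* ∣ u ∣) ℤ.+ p) (ℤ.pos-* (suc m) _) ⟩
    + (∣ u ∣ ℕ.* ∣ u ∣) ℤ.+ + suc m ℤ.* + (∣ v ∣ ℕ.* ∣ v ∣)
      ≡⟨ cong₂ (λ p q → p ℤ.+ + suc m ℤ.* q) (i*i≡∣i∣*∣i∣ u) (i*i≡∣i∣*∣i∣ v) ⟨
    u ℤ.* u ℤ.+ + suc m ℤ.* (v ℤ.* v)
      ≡⟨ eq ⟩
    + 0 ∎)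
    where open ≡-Reasoning
  ∣u∣²≡0 : ∣ u ∣ ℕ.* ∣ u ∣ ≡ 0
  ∣u∣²≡0 = ℕ.m+n≡0⇒m≡0 _ in-ℕ
  ∣v∣²≡0 : ∣ v ∣ ℕ.* ∣ v ∣ ≡ 0
  ∣v∣²≡0 = [ (λ ()) , (λ p → p) ]′ (ℕ.m*n≡0⇒m≡0∨n≡0 (suc m) (ℕ.m+n≡0⇒n≡0 (∣ u ∣ ℕ.* ∣ u ∣) in-ℕ))
  square≡0 : ∀ i → ∣ i ∣ ℕ.* ∣ i ∣ ≡ 0 → i ≡ + 0
  square≡0 i sq≡0 = ℤ.∣i∣≡0⇒i≡0 ([ (λ p → p) , (λ p → p) ]′ (ℕ.m*n≡0⇒m≡0∨n≡0 ∣ i ∣ sq≡0))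

norm-form-anisotropic : ∀ t n m → + 4 ℤ.* n ℤ.- t ℤ.* t ≡ + suc m →
  ∀ a b → a ℤ.* a ℤ.+ t ℤ.* (a ℤ.* b) ℤ.+ n ℤ.* (b ℤ.* b) ≡ + 0 → a ≡ + 0 × b ≡ + 0
norm-form-anisotropic t n m disc a b form≡0 = a≡0 , b≡0
  where
  open ≡-Reasoning
  completed : (a ℤ.+ a ℤ.+ t ℤ.* b) ℤ.* (a ℤ.+ a ℤ.+ t ℤ.* b) ℤ.+ + suc m ℤ.* (b ℤ.* b) ≡ + 0
  completed = begin
    (a ℤ.+ a ℤ.+ t ℤ.* b) ℤ.* (a ℤ.+ a ℤ.+ t ℤ.* b) ℤ.+ + suc m ℤ.* (b ℤ.* b)
      ≡⟨ cong (λ d → (a ℤ.+ a ℤ.+ t ℤ.* b) ℤ.* (a ℤ.+ a ℤ.+ t ℤ.* b) ℤ.+ d ℤ.* (b ℤ.* b)) disc ⟨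
    (a ℤ.+ a ℤ.+ t ℤ.* b) ℤ.* (a ℤ.+ a ℤ.+ t ℤ.* b) ℤ.+ (+ 4 ℤ.* n ℤ.- t ℤ.* t) ℤ.* (b ℤ.* b)
      ≡⟨ complete-square t n a b ⟩
    + 4 ℤ.* (a ℤ.* a ℤ.+ t ℤ.* (a ℤ.* b) ℤ.+ n ℤ.* (b ℤ.* b))
      ≡⟨ cong (+ 4 ℤ.*_) form≡0 ⟩
    + 0 ∎
    where
    complete-square : ∀ t n a b →
      (a ℤ.+ a ℤ.+ t ℤ.* b) ℤ.* (a ℤ.+ a ℤ.+ t ℤ.* b) ℤ.+ (+ 4 ℤ.* n ℤ.- t ℤ.* t) ℤ.* (b ℤ.* b)
      ≡ + 4 ℤ.* (a ℤ.* a ℤ.+ t ℤ.* (a ℤ.* b) ℤ.+ n ℤ.* (b ℤ.* b))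
    complete-square = solve-∀
  both≡0 : a ℤ.+ a ℤ.+ t ℤ.* b ≡ + 0 × b ≡ + 0
  both≡0 = square-plus-positive≡0 (a ℤ.+ a ℤ.+ t ℤ.* b) b m completed
  b≡0 : b ≡ + 0
  b≡0 = proj₂ both≡0
  a≡0 : a ≡ + 0
  a≡0 = [ (λ ()) , (λ p → p) ]′ (ℤ.i*j≡0⇒i≡0∨j≡0 (+ 2) (begin
    + 2 ℤ.* a               ≡⟨ double t a b ⟩
    a ℤ.+ a ℤ.+ t ℤ.* b ℤ.- t ℤ.* b   ≡⟨ cong₂ (λ p q → p ℤ.- t ℤ.* q) (proj₁ both≡0) b≡0 ⟩
    + 0 ℤ.- t ℤ.* + 0       ≡⟨ cong (λ p → + 0 ℤ.- p) (ℤ.*-zeroʳ t) ⟩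
    + 0 ∎))
    where
    double : ∀ t a b → + 2 ℤ.* a ≡ a ℤ.+ a ℤ.+ t ℤ.* b ℤ.- t ℤ.* b
    double = solve-∀

square∣discriminant : ∀ t n e f k g → e ℤ.* k ≡ f ℤ.* (f ℤ.+ t) ℤ.+ n →
  + g ℤ∣.∣ e → + g ℤ∣.∣ f ℤ.+ (f ℤ.+ t) → + g ℤ∣.∣ k → + (g ℕ.* g) ℤ∣.∣ + 4 ℤ.* n ℤ.- t ℤ.* t
square∣discriminant t n .(e′ ℤ.* + g) f .(k′ ℤ.* + g) g ek≡N (divides e′ refl) (divides c tr≡cg) (divides k′ refl) =
  divides (+ 4 ℤ.* e′ ℤ.* k′ ℤ.- c ℤ.* c) (begin
    + 4 ℤ.* n ℤ.- t ℤ.* t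
      ≡⟨ discriminant-identity t n f ⟩
    + 4 ℤ.* (f ℤ.* (f ℤ.+ t) ℤ.+ n) ℤ.- (f ℤ.+ (f ℤ.+ t)) ℤ.* (f ℤ.+ (f ℤ.+ t))
      ≡⟨ cong₂ (λ p q → + 4 ℤ.* p ℤ.- q ℤ.* q) (sym ek≡N) tr≡cg ⟩
    + 4 ℤ.* (e′ ℤ.* + g ℤ.* (k′ ℤ.* + g)) ℤ.- c ℤ.* + g ℤ.* (c ℤ.* + g)
      ≡⟨ factor e′ k′ c (+ g) ⟩
    (+ 4 ℤ.* e′ ℤ.* k′ ℤ.- c ℤ.* c) ℤ.* (+ g ℤ.* + g)
      ≡⟨ cong (λ p → (+ 4 ℤ.* e′ ℤ.* k′ ℤ.- c ℤ.* c) ℤ.* p) (ℤ.pos-* g g) ⟨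
    (+ 4 ℤ.* e′ ℤ.* k′ ℤ.- c ℤ.* c) ℤ.* + (g ℕ.* g) ∎)
  where
  open ≡-Reasoning
  discriminant-identity : ∀ t n f → + 4 ℤ.* n ℤ.- t ℤ.* t
    ≡ + 4 ℤ.* (f ℤ.* (f ℤ.+ t) ℤ.+ n) ℤ.- (f ℤ.+ (f ℤ.+ t)) ℤ.* (f ℤ.+ (f ℤ.+ t))
  discriminant-identity = solve-∀
  factor : ∀ e′ k′ c g → + 4 ℤ.* (e′ ℤ.* g ℤ.* (k′ ℤ.* g)) ℤ.- c ℤ.* g ℤ.* (c ℤ.* g)
                         ≡ (+ 4 ℤ.* e′ ℤ.* k′ ℤ.- c ℤ.* c) ℤ.* (g ℤ.* g)
  factor = solve-∀

square∣n : ∀ n e f k g → e ℤ.* k ≡ f ℤ.* (f ℤ.+ + 0) ℤ.+ n →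
  + g ℤ∣.∣ e → + g ℤ∣.∣ f → + g ℤ∣.∣ k → + (g ℕ.* g) ℤ∣.∣ n
square∣n n .(e′ ℤ.* + g) .(f′ ℤ.* + g) .(k′ ℤ.* + g) g ek≡N (divides e′ refl) (divides f′ refl) (divides k′ refl) =
  divides (e′ ℤ.* k′ ℤ.- f′ ℤ.* f′) (begin
    n                                                        ≡⟨ isolate n (f′ ℤ.* + g) ⟩
    n ℤ.+ f′ ℤ.* + g ℤ.* (f′ ℤ.* + g ℤ.+ + 0) ℤ.- f′ ℤ.* + g ℤ.* (f′ ℤ.* + g ℤ.+ + 0)
      ≡⟨ cong (λ p → p ℤ.- f′ ℤ.* + g ℤ.* (f′ ℤ.* + g ℤ.+ + 0)) (trans (ℤ.+-comm n _) (sym ek≡N)) ⟩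
    e′ ℤ.* + g ℤ.* (k′ ℤ.* + g) ℤ.- f′ ℤ.* + g ℤ.* (f′ ℤ.* + g ℤ.+ + 0)
      ≡⟨ factor e′ k′ f′ (+ g) ⟩
    (e′ ℤ.* k′ ℤ.- f′ ℤ.* f′) ℤ.* (+ g ℤ.* + g)
      ≡⟨ cong (λ p → (e′ ℤ.* k′ ℤ.- f′ ℤ.* f′) ℤ.* p) (ℤ.pos-* g g) ⟨
    (e′ ℤ.* k′ ℤ.- f′ ℤ.* f′) ℤ.* + (g ℕ.* g) ∎)
  where
  open ≡-Reasoning
  isolate : ∀ n x → n ≡ n ℤ.+ x ℤ.* (x ℤ.+ + 0) ℤ.- x ℤ.* (x ℤ.+ + 0)
  isolate = solve-∀
  factor : ∀ e′ k′ f′ g → e′ ℤ.* g ℤ.* (k′ ℤ.* g) ℤ.- f′ ℤ.* g ℤ.* (f′ ℤ.* g ℤ.+ + 0)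
                          ≡ (e′ ℤ.* k′ ℤ.- f′ ℤ.* f′) ℤ.* (g ℤ.* g)
  factor = solve-∀

even-or-odd : ∀ m → ∃[ h ] (m ≡ h ℕ.+ h ⊎ m ≡ suc (h ℕ.+ h))
even-or-odd zero    = 0 , inj₁ refl
even-or-odd (suc m) with even-or-odd m
... | h , inj₁ refl = h , inj₂ refl
... | h , inj₂ refl = suc h , inj₁ (cong suc (sym (ℕ.+-suc h h)))

odd∣double⇒∣ : ∀ h f → + suc (h ℕ.+ h) ℤ∣.∣ f ℤ.+ (f ℤ.+ + 0) → + suc (h ℕ.+ h) ℤ∣.∣ f
odd∣double⇒∣ h f (divides c 2f≡cg) = divides (f ℤ.- c ℤ.* + h) (begin
  f                                                   ≡⟨ expand f (+ h) ⟩
  f ℤ.* (+ 1 ℤ.+ (+ h ℤ.+ + h)) ℤ.- + h ℤ.* (f ℤ.+ (f ℤ.+ + 0))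
    ≡⟨ cong₂ (λ p q → f ℤ.* p ℤ.- + h ℤ.* q) (sym g≡1+2h) 2f≡cg ⟩
  f ℤ.* + suc (h ℕ.+ h) ℤ.- + h ℤ.* (c ℤ.* + suc (h ℕ.+ h))
    ≡⟨ collect f c (+ h) (+ suc (h ℕ.+ h)) ⟩
  (f ℤ.- c ℤ.* + h) ℤ.* + suc (h ℕ.+ h) ∎)
  where
  open ≡-Reasoning
  g≡1+2h : + suc (h ℕ.+ h) ≡ + 1 ℤ.+ (+ h ℤ.+ + h)
  g≡1+2h = cong (λ p → + 1 ℤ.+ p) (ℤ.pos-+ h h)
  expand : ∀ f h → f ≡ f ℤ.* (+ 1 ℤ.+ (h ℤ.+ h)) ℤ.- h ℤ.* (f ℤ.+ (f ℤ.+ + 0))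
  expand = solve-∀
  collect : ∀ f c h g → f ℤ.* g ℤ.- h ℤ.* (c ℤ.* g) ≡ (f ℤ.- c ℤ.* h) ℤ.* g
  collect = solve-∀

no-square+D≡0-mod-4 : ∀ D → SquareFree D → ¬ D % 4 ≡ 3 → ∀ F M → ¬ F ℕ.* F ℕ.+ D ≡ 4 ℕ.* M
no-square+D≡0-mod-4 D sf D%4≢3 F M F²+D≡4M with even-or-odd F
... | h , inj₁ refl = 2≢1 (sf 2 (ℕ.∣m+n∣m⇒∣n 4∣F²+D (ℕ.divides (h ℕ.* h) (even-square h))))
  where
  2≢1 : ¬ 2 ≡ 1
  2≢1 ()
  4∣F²+D : 4 ℕ.∣ (h ℕ.+ h) ℕ.* (h ℕ.+ h) ℕ.+ D
  4∣F²+D = ℕ.divides M (trans F²+D≡4M (ℕ.*-comm 4 M))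
  even-square : ∀ h → (h ℕ.+ h) ℕ.* (h ℕ.+ h) ≡ h ℕ.* h ℕ.* 4
  even-square = ℕ-Solver.solve-∀
... | h , inj₂ refl = D%4≢3 (%-pred-≡0 {D} (ℕ.n∣m⇒m%n≡0 (suc D) 4 4∣D+1))
  where
  odd-square : ∀ h D → suc (h ℕ.+ h) ℕ.* suc (h ℕ.+ h) ℕ.+ D ≡ (h ℕ.* h ℕ.+ h) ℕ.* 4 ℕ.+ suc D
  odd-square = ℕ-Solver.solve-∀
  4∣D+1 : 4 ℕ.∣ suc D
  4∣D+1 = ℕ.∣m+n∣m⇒∣n (ℕ.divides M (trans (sym (odd-square h D)) (trans F²+D≡4M (ℕ.*-comm 4 M))))
                      (ℕ.divides (h ℕ.* h ℕ.+ h) refl)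

no-even-common-divisor : ∀ D → SquareFree D → ¬ D % 4 ≡ 3 → ∀ e f k h →
  e ℤ.* k ≡ f ℤ.* (f ℤ.+ + 0) ℤ.+ + D → + (h ℕ.+ h) ℤ∣.∣ e → + (h ℕ.+ h) ℤ∣.∣ k → ⊥
no-even-common-divisor D sf D%4≢3 .(e′ ℤ.* + (h ℕ.+ h)) f .(k′ ℤ.* + (h ℕ.+ h)) h ek≡N
                        (divides e′ refl) (divides k′ refl) =
  no-square+D≡0-mod-4 D sf D%4≢3 ∣ f ∣ ∣ X ∣ (begin
    ∣ f ∣ ℕ.* ∣ f ∣ ℕ.+ D     ≡⟨ cong ∣_∣ in-ℤ ⟩
    ∣ + 4 ℤ.* X ∣             ≡⟨ ℤ.abs-* (+ 4) X ⟩
    4 ℕ.* ∣ X ∣               ∎)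
  where
  open ≡-Reasoning
  X : ℤ
  X = e′ ℤ.* k′ ℤ.* + h ℤ.* + h
  in-ℤ : + (∣ f ∣ ℕ.* ∣ f ∣ ℕ.+ D) ≡ + 4 ℤ.* X
  in-ℤ = begin
    + (∣ f ∣ ℕ.* ∣ f ∣ ℕ.+ D)                          ≡⟨ ℤ.pos-+ (∣ f ∣ ℕ.* ∣ f ∣) D ⟩
    + (∣ f ∣ ℕ.* ∣ f ∣) ℤ.+ + D                        ≡⟨ cong (ℤ._+ + D) (i*i≡∣i∣*∣i∣ f) ⟨
    f ℤ.* f ℤ.+ + D                                    ≡⟨ cong (λ p → f ℤ.* p ℤ.+ + D) (ℤ.+-identityʳ f) ⟨
    f ℤ.* (f ℤ.+ + 0) ℤ.+ + D                          ≡⟨ ek≡N ⟨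
    e′ ℤ.* + (h ℕ.+ h) ℤ.* (k′ ℤ.* + (h ℕ.+ h))        ≡⟨ cong (λ p → e′ ℤ.* p ℤ.* (k′ ℤ.* p)) (ℤ.pos-+ h h) ⟩
    e′ ℤ.* (+ h ℤ.+ + h) ℤ.* (k′ ℤ.* (+ h ℤ.+ + h))    ≡⟨ four-factors e′ k′ (+ h) ⟩
    + 4 ℤ.* X                                          ∎
    where
    four-factors : ∀ e′ k′ h → e′ ℤ.* (h ℤ.+ h) ℤ.* (k′ ℤ.* (h ℤ.+ h)) ≡ + 4 ℤ.* (e′ ℤ.* k′ ℤ.* h ℤ.* h)
    four-factors = solve-∀

MinimalPolynomialCases : ℕ → Set
MinimalPolynomialCases D = (D % 4 ≡ 3 × QuadInt.t D ≡ + 1 × QuadInt.n D ≡ + ((D ℕ.+ 1) / 4))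
                         ⊎ (¬ D % 4 ≡ 3 × QuadInt.t D ≡ + 0 × QuadInt.n D ≡ + D)

minimal-polynomial-cases : ∀ D → MinimalPolynomialCases D
minimal-polynomial-cases D = by-case (D % 4 ≡ᵇ 3) refl
  where
  t-if n-if : Bool → ℤ
  t-if b = if b then + 1 else + 0
  n-if b = if b then + ((D ℕ.+ 1) / 4) else + D
  by-case : ∀ b → (D % 4 ≡ᵇ 3) ≡ b → MinimalPolynomialCases D
  by-case true  eq = inj₁ (ℕ.≡ᵇ⇒≡ (D % 4) 3 (subst T (sym eq) _) , cong t-if eq , cong n-if eq)
  by-case false eq = inj₂ ((λ D%4≡3 → subst T eq (ℕ.≡⇒≡ᵇ (D % 4) 3 D%4≡3)) , cong t-if eq , cong n-if eq)

4[D+1]/4≡D+1 : ∀ D → D % 4 ≡ 3 → 4 ℕ.* ((D ℕ.+ 1) / 4) ≡ D ℕ.+ 1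
4[D+1]/4≡D+1 D D%4≡3 = begin
  4 ℕ.* ((D ℕ.+ 1) / 4)       ≡⟨ cong (λ m → 4 ℕ.* (m / 4)) D+1≡[1+q]4 ⟩
  4 ℕ.* ((1 ℕ.+ q) ℕ.* 4 / 4) ≡⟨ cong (4 ℕ.*_) (m*n/n≡m (1 ℕ.+ q) 4) ⟩
  4 ℕ.* (1 ℕ.+ q)             ≡⟨ ℕ.*-comm 4 (1 ℕ.+ q) ⟩
  (1 ℕ.+ q) ℕ.* 4             ≡⟨ D+1≡[1+q]4 ⟨
  D ℕ.+ 1                     ∎
  where
  open ≡-Reasoning
  q : ℕ
  q = D / 4
  D+1≡[1+q]4 : D ℕ.+ 1 ≡ (1 ℕ.+ q) ℕ.* 4
  D+1≡[1+q]4 = trans (cong (ℕ._+ 1) (trans (m≡m%n+[m/n]*n D 4) (cong (ℕ._+ q ℕ.* 4) D%4≡3))) (rearrange q)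
    where
    rearrange : ∀ q → 3 ℕ.+ q ℕ.* 4 ℕ.+ 1 ≡ (1 ℕ.+ q) ℕ.* 4
    rearrange = ℕ-Solver.solve-∀

discriminant-≡3 : ∀ D → D % 4 ≡ 3 → + 4 ℤ.* + ((D ℕ.+ 1) / 4) ℤ.- + 1 ℤ.* + 1 ≡ + D
discriminant-≡3 D D%4≡3 = begin
  + 4 ℤ.* + ((D ℕ.+ 1) / 4) ℤ.- + 1 ℤ.* + 1   ≡⟨ cong (ℤ._- + 1) (sym (ℤ.pos-* 4 ((D ℕ.+ 1) / 4))) ⟩
  + (4 ℕ.* ((D ℕ.+ 1) / 4)) ℤ.- + 1           ≡⟨ cong (λ m → + m ℤ.- + 1) (4[D+1]/4≡D+1 D D%4≡3) ⟩
  + (D ℕ.+ 1) ℤ.- + 1                         ≡⟨ cong (ℤ._- + 1) (ℤ.pos-+ D 1) ⟩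
  + D ℤ.+ + 1 ℤ.- + 1                         ≡⟨ cancel (+ D) ⟩
  + D                                         ∎
  where
  open ≡-Reasoning
  cancel : ∀ d → d ℤ.+ + 1 ℤ.- + 1 ≡ d
  cancel = solve-∀

discriminant-positive : ∀ D → 1 ℕ.≤ D → ∃[ m ] (+ 4 ℤ.* QuadInt.n D ℤ.- QuadInt.t D ℤ.* QuadInt.t D ≡ + suc m)
discriminant-positive D@(suc D′) (ℕ.s≤s ℕ.z≤n) with minimal-polynomial-cases D
... | inj₁ (D%4≡3 , t≡1 , n≡) = D′ , trans (cong₂ (λ t n → + 4 ℤ.* n ℤ.- t ℤ.* t) t≡1 n≡) (discriminant-≡3 D D%4≡3)
... | inj₂ (_ , t≡0 , n≡D)    = _ , cong₂ (λ t n → + 4 ℤ.* n ℤ.- t ℤ.* t) t≡0 n≡D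

N≡0⇒≡0 : ∀ D → 1 ℕ.≤ D → ∀ x → QuadraticRing.N D x ≡ + 0 → x ≡ QuadInt.0ₒ D
N≡0⇒≡0 D 1≤D (a QuadInt.+ b ω) Nx≡0 =
  let m , disc = discriminant-positive D 1≤D
      a≡0 , b≡0 = norm-form-anisotropic (QuadInt.t D) (QuadInt.n D) m disc a b Nx≡0
  in cong₂ (λ u v → u QuadInt.+ v ω) a≡0 b≡0

norm-trace-coprime-≡3 : ∀ D → SquareFree D → D % 4 ≡ 3 → NormTraceCoprime (+ 1) (+ ((D ℕ.+ 1) / 4))
norm-trace-coprime-≡3 D sf D%4≡3 e f k ek≡N g g∣e g∣tr g∣k =
  sf g (∣⇒∣ᵤ (subst (+ (g ℕ.* g) ℤ∣.∣_) (discriminant-≡3 D D%4≡3)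
                    (square∣discriminant (+ 1) _ e f k g ek≡N g∣e g∣tr g∣k)))

norm-trace-coprime-≢3 : ∀ D → SquareFree D → ¬ D % 4 ≡ 3 → NormTraceCoprime (+ 0) (+ D)
norm-trace-coprime-≢3 D sf D%4≢3 e f k ek≡N g g∣e g∣tr g∣k with even-or-odd g
... | h , inj₂ refl = sf g (∣⇒∣ᵤ (square∣n (+ D) e f k g ek≡N g∣e (odd∣double⇒∣ h f g∣tr) g∣k))
... | h , inj₁ refl = ⊥-elim (no-even-common-divisor D sf D%4≢3 e f k h ek≡N g∣e g∣k)

norm-trace-coprime : ∀ D → SquareFree D → NormTraceCoprime (QuadInt.t D) (QuadInt.n D)
norm-trace-coprime D sf with minimal-polynomial-cases D
... | inj₁ (D%4≡3 , t≡1 , n≡)  = subst₂ NormTraceCoprime (sym t≡1) (sym n≡) (norm-trace-coprime-≡3 D sf D%4≡3)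
... | inj₂ (D%4≢3 , t≡0 , n≡D) = subst₂ NormTraceCoprime (sym t≡0) (sym n≡D) (norm-trace-coprime-≢3 D sf D%4≢3)

theorem12 : (D : ℕ) → 1 ≤ D → SquareFree D →
            (x : QuadInt.Rep D) →
            QuadInt.InfiniteP1 D (QuadInt.FareyNeighbours D x)
theorem12 D 1≤D squarefree x =
  infinitely-many-neighbours x (partner-exists (num x) (den x) (nonzero x))
  where
  open QuadInt D
  open FareyQuadruples D (N≡0⇒≡0 D 1≤D)
  open PartnerExistence D (N≡0⇒≡0 D 1≤D) (norm-trace-coprime D squarefree)
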